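{- Let $\lambda$ be a positive integer which is a sum of two squares of rational integers. Then every icube in $\mathbb{Z}[i]^3$ of norm $\lambda$ can be extended to a $3$-icube in $\mathbb{Z}[i]^3$.
   Context: For a complex matrix $M$, $M^*=\overline{M}^T$. For $1\leq k\leq n$, a matrix $(v_1|\dots|v_k)\in\mathbb{Z}[i]^{n\times k}$ is a $k$-icube in $\mathbb{Z}[i]^n$ of norm $\lambda>0$ if $v_i^*v_j=\lambda$ for $i=j$ and $v_i^*v_j=0$ for $i\neq j$. An icube is a $k$-icube for some $1\leq k\leq n$. For $\ell<k$, an $\ell$-icube $A$ can be extended to a $k$-icube if some $\ell$ columns of some $k$-icube form $A$. -}

module Defs where

open import Data.Nat using (ℕ; suc; _≤_)
open import Data.Integer using (ℤ; +_; _+_; _*_; -_; _>_)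
open import Data.Product using (_×_; _,_; proj₁; proj₂; Σ; ∃)
open import Data.Fin using (Fin; zero; suc)
open import Relation.Binary.PropositionalEquality using (_≡_; _≢_)
open import Function.Definitions using (Injective)

-- Gaussian integers ℤ[i], represented as pairs (re , im) meaning re + im·i
ℤ[i] : Set
ℤ[i] = ℤ × ℤ

re im : ℤ[i] → ℤ
re = proj₁
im = proj₂

0ᵍ : ℤ[i]
0ᵍ = (+ 0 , + 0)

_+ᵍ_ : ℤ[i] → ℤ[i] → ℤ[i]
(a , b) +ᵍ (c , d) = (a + c , b + d)

_*ᵍ_ : ℤ[i] → ℤ[i] → ℤ[i]
(a , b) *ᵍ (c , d) = (a * c + - (b * d) , a * d + b * c)

conj : ℤ[i] → ℤ[i]
conj (a , b) = (a , - b)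

ι : ℤ → ℤ[i]
ι a = (a , + 0)

Vecᵍ : ℕ → Set
Vecᵍ n = Fin n → ℤ[i]

sumᵍ : ∀ {n} → (Fin n → ℤ[i]) → ℤ[i]
sumᵍ {ℕ.zero} f = 0ᵍ
sumᵍ {suc n} f = f zero +ᵍ sumᵍ (λ j → f (suc j))

_⋆_ : ∀ {n} → Vecᵍ n → Vecᵍ n → ℤ[i]
v ⋆ w = sumᵍ (λ a → conj (v a) *ᵍ w a)

-- an n × k matrix over ℤ[i], given by its k columns (each in ℤ[i]^n)
Mat : ℕ → ℕ → Set
Mat n k = Fin k → Vecᵍ n

IsICube : (n k : ℕ) → ℤ → Mat n k → Set
IsICube n k lam M =
  1 ≤ k × k ≤ n × lam > + 0 ×
  (∀ i → M i ⋆ M i ≡ ι lam) ×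
  (∀ i j → i ≢ j → M i ⋆ M j ≡ 0ᵍ)

-- the ℓ-icube A can be extended to a k-icube (of the same norm, as forced by
-- orthogonality relations): some ℓ columns of some k-icube B form A, i.e.
-- there is an injective choice of columns σ with column σ j of B equal to
-- column j of A.
ExtendsTo : (n ℓ k : ℕ) → ℤ → Mat n ℓ → Set
ExtendsTo n ℓ k lam A =
  Σ (Mat n k) λ B → IsICube n k lam B ×
  Σ (Fin ℓ → Fin k) λ σ → Injective _≡_ _≡_ σ × (∀ j → B (σ j) ≡ A j)

SumOfTwoSquares : ℤ → Set
SumOfTwoSquares lam = ∃ λ a → ∃ λ b → lam ≡ a * a + b * b

-- Write λ = c c̄ with c = a + b i.  Two orthogonal columns u, v of norm λ are completed by
-- w = ū × v̄: it is orthogonal to both, w ⋆ w = λ², and by the Binet–Cauchy identity λ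
-- divides every wᵢ w̄ⱼ.  A Bézout argument for gcd(c, w₁, w₂, w₃) then yields σ with
-- σ σ̄ = λ dividing w, and w / σ is the third column.  A single column v is completed
-- through the isotropic vector (v, c) of the form |x₁|² + |x₂|² + |x₃|² − |x₄|² on ℤ[i]⁴:
-- a descent on |x₄ − x₃|² by Eichler transformations and unit rescalings finds z with
-- ⟨(v, c), z⟩ = 0 and ⟨z, z⟩ = 1, and then c (z₁, z₂, z₃) − z₄ v is a second column.

module Submission where

open import Defs renaming (_+ᵍ_ to infixl 6 _+ᵍ_; _*ᵍ_ to infixl 7 _*ᵍ_)
open import Algebra.Bundles using (CommutativeRing)
open import Algebra.Bundles.Raw using (RawRing)
open import Algebra.Structures using (IsCommutativeRing)
open import Data.Bool using (if_then_else_)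
open import Data.Empty using (⊥-elim)
open import Data.Fin as Fin using (Fin; zero; suc; #_; _↑ˡ_; _↑ʳ_; inject₁)
open import Data.Fin.Properties using (inject₁-injective)
open import Data.Integer as ℤ
  using (ℤ; +_; -_; -[1+_]; _-_; 0ℤ; _≤_; _<_; _>_; _≤?_; +≤+; +<+; _/ℕ_; _%ℕ_; ∣_∣)
  renaming (_+_ to _+ℤ_; _*_ to _*ℤ_)
open import Data.Integer.DivMod using (a≡a%ℕn+[a/ℕn]*n; n%ℕd<d)
import Data.Integer.Properties as ℤ
import Data.Integer.Tactic.RingSolver as ℤ-Solver
open import Data.Maybe using (Maybe; just; nothing)
open import Data.Nat as ℕ using (ℕ; zero; suc; z≤n; s≤s)
import Data.Nat.Properties as ℕ
open import Data.Nat.Induction using (<-wellFounded)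
open import Data.Product using (∃; _×_; _,_; proj₁; proj₂)
import Data.Product.Properties as Product
open import Data.Sum as Sum using (_⊎_; inj₁; inj₂; [_,_]′)
open import Data.Vec using (Vec)
open import Data.Vec.Functional using (_∷_; []; head; tail; toVec)
open import Function using (_∘_; id)
open import Induction.WellFounded using (Acc; acc; module All)
open import Level using (0ℓ)
import Relation.Binary.Construct.On as On
open import Relation.Binary.Definitions using (Tri; tri<; tri≈; tri>)
open import Relation.Binary.PropositionalEquality
open import Relation.Nullary using (Dec; yes; no; does)
open import Relation.Nullary.Decidable using (toSum)
open import Tactic.RingSolver using (solve-∀)
open import Tactic.RingSolver.Core.AlmostCommutativeRing using (AlmostCommutativeRing; fromCommutativeRing)

infixl 6 _-ᵍ_
infix 8 -ᵍ_

-ᵍ_ : ℤ[i] → ℤ[i]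
-ᵍ (a , b) = (- a , - b)

_-ᵍ_ : ℤ[i] → ℤ[i] → ℤ[i]
x -ᵍ y = x +ᵍ -ᵍ y

1ᵍ iᵍ : ℤ[i]
1ᵍ = (+ 1 , + 0)
iᵍ = (+ 0 , + 1)

ℤ[i]-isCommutativeRing : IsCommutativeRing _≡_ _+ᵍ_ _*ᵍ_ (-ᵍ_) 0ᵍ 1ᵍ
ℤ[i]-isCommutativeRing = record
  { isRing = record
    { +-isAbelianGroup = record
      { isGroup = record
        { isMonoid = record
          { isSemigroup = record
            { isMagma = record { isEquivalence = isEquivalence ; ∙-cong = cong₂ _+ᵍ_ }
            ; assoc = λ (a , b) (c , d) (e , f) → cong₂ _,_ (ℤ.+-assoc a c e) (ℤ.+-assoc b d f) }
          ; identity = (λ (a , b) → cong₂ _,_ (ℤ.+-identityˡ a) (ℤ.+-identityˡ b))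
                     , (λ (a , b) → cong₂ _,_ (ℤ.+-identityʳ a) (ℤ.+-identityʳ b)) }
        ; inverse = (λ (a , b) → cong₂ _,_ (ℤ.+-inverseˡ a) (ℤ.+-inverseˡ b))
                  , (λ (a , b) → cong₂ _,_ (ℤ.+-inverseʳ a) (ℤ.+-inverseʳ b))
        ; ⁻¹-cong = cong (-ᵍ_) }
      ; comm = λ (a , b) (c , d) → cong₂ _,_ (ℤ.+-comm a c) (ℤ.+-comm b d) }
    ; *-cong = cong₂ _*ᵍ_
    ; *-assoc = λ (a , b) (c , d) (e , f) → cong₂ _,_ (*-assoc-re a b c d e f) (*-assoc-im a b c d e f)
    ; *-identity = (λ (a , b) → cong₂ _,_ (*-identityˡ-re a b) (*-identityˡ-im a b))
                 , (λ (a , b) → cong₂ _,_ (*-identityʳ-re a b) (*-identityʳ-im a b))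
    ; distrib = (λ (a , b) (c , d) (e , f) → cong₂ _,_ (*-distribˡ-re a b c d e f) (*-distribˡ-im a b c d e f))
              , (λ (a , b) (c , d) (e , f) → cong₂ _,_ (*-distribʳ-re a b c d e f) (*-distribʳ-im a b c d e f)) }
  ; *-comm = λ (a , b) (c , d) → cong₂ _,_ (*-comm-re a b c d) (*-comm-im a b c d) }
  where
  *-assoc-re : ∀ a b c d e f → (a *ℤ c - b *ℤ d) *ℤ e - (a *ℤ d +ℤ b *ℤ c) *ℤ f ≡ a *ℤ (c *ℤ e - d *ℤ f) - b *ℤ (c *ℤ f +ℤ d *ℤ e)
  *-assoc-re = ℤ-Solver.solve-∀
  *-assoc-im : ∀ a b c d e f → (a *ℤ c - b *ℤ d) *ℤ f +ℤ (a *ℤ d +ℤ b *ℤ c) *ℤ e ≡ a *ℤ (c *ℤ f +ℤ d *ℤ e) +ℤ b *ℤ (c *ℤ e - d *ℤ f)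
  *-assoc-im = ℤ-Solver.solve-∀
  *-identityˡ-re : ∀ a b → + 1 *ℤ a - + 0 *ℤ b ≡ a
  *-identityˡ-re = ℤ-Solver.solve-∀
  *-identityˡ-im : ∀ a b → + 1 *ℤ b +ℤ + 0 *ℤ a ≡ b
  *-identityˡ-im = ℤ-Solver.solve-∀
  *-identityʳ-re : ∀ a b → a *ℤ + 1 - b *ℤ + 0 ≡ a
  *-identityʳ-re = ℤ-Solver.solve-∀
  *-identityʳ-im : ∀ a b → a *ℤ + 0 +ℤ b *ℤ + 1 ≡ b
  *-identityʳ-im = ℤ-Solver.solve-∀
  *-distribˡ-re : ∀ a b c d e f → a *ℤ (c +ℤ e) - b *ℤ (d +ℤ f) ≡ (a *ℤ c - b *ℤ d) +ℤ (a *ℤ e - b *ℤ f)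
  *-distribˡ-re = ℤ-Solver.solve-∀
  *-distribˡ-im : ∀ a b c d e f → a *ℤ (d +ℤ f) +ℤ b *ℤ (c +ℤ e) ≡ (a *ℤ d +ℤ b *ℤ c) +ℤ (a *ℤ f +ℤ b *ℤ e)
  *-distribˡ-im = ℤ-Solver.solve-∀
  *-distribʳ-re : ∀ a b c d e f → (c +ℤ e) *ℤ a - (d +ℤ f) *ℤ b ≡ (c *ℤ a - d *ℤ b) +ℤ (e *ℤ a - f *ℤ b)
  *-distribʳ-re = ℤ-Solver.solve-∀
  *-distribʳ-im : ∀ a b c d e f → (c +ℤ e) *ℤ b +ℤ (d +ℤ f) *ℤ a ≡ (c *ℤ b +ℤ d *ℤ a) +ℤ (e *ℤ b +ℤ f *ℤ a)
  *-distribʳ-im = ℤ-Solver.solve-∀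
  *-comm-re : ∀ a b c d → a *ℤ c - b *ℤ d ≡ c *ℤ a - d *ℤ b
  *-comm-re = ℤ-Solver.solve-∀
  *-comm-im : ∀ a b c d → a *ℤ d +ℤ b *ℤ c ≡ c *ℤ b +ℤ d *ℤ a
  *-comm-im = ℤ-Solver.solve-∀

ℤ[i]-commutativeRing : CommutativeRing _ _
ℤ[i]-commutativeRing = record { isCommutativeRing = ℤ[i]-isCommutativeRing }

ℤ[i]-ring : AlmostCommutativeRing _ _
ℤ[i]-ring = fromCommutativeRing ℤ[i]-commutativeRing is-0ᵍ
  where
  is-0ᵍ : (x : ℤ[i]) → Maybe (0ᵍ ≡ x)
  is-0ᵍ (+ zero , + zero) = just refl
  is-0ᵍ _                 = nothing

open CommutativeRing ℤ[i]-commutativeRing public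
  using ()
  renaming ( +-identityʳ to +ᵍ-identityʳ; +-identityˡ to +ᵍ-identityˡ
           ; *-comm to *ᵍ-comm; *-assoc to *ᵍ-assoc; zeroˡ to *ᵍ-zeroˡ; zeroʳ to *ᵍ-zeroʳ
           ; distribʳ to *ᵍ-distribʳ-+ᵍ; distribˡ to *ᵍ-distribˡ-+ᵍ
           ; *-identityʳ to *ᵍ-identityʳ; *-identityˡ to *ᵍ-identityˡ
           ; *-commutativeSemigroup to ℤ[i]-*-commutativeSemigroup)

open import Algebra.Properties.CommutativeSemigroup.Divisibility ℤ[i]-*-commutativeSemigroup
  using (_∣_; _,_; ∣ʳ-trans; x∣ʳy⇒x∣ʳzy; x∣xy; ∙-cong-∣)

norm : ℤ[i] → ℤ
norm (a , b) = a *ℤ a +ℤ b *ℤ b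

conj-involutive : ∀ x → conj (conj x) ≡ x
conj-involutive (a , b) = cong (a ,_) (ℤ.neg-involutive b)

conj-+ᵍ : ∀ x y → conj (x +ᵍ y) ≡ conj x +ᵍ conj y
conj-+ᵍ (a , b) (c , d) = cong (a +ℤ c ,_) (ℤ.neg-distrib-+ b d)

conj-*ᵍ : ∀ x y → conj (x *ᵍ y) ≡ conj x *ᵍ conj y
conj-*ᵍ (a , b) (c , d) = cong₂ _,_ (re-eq a b c d) (im-eq a b c d)
  where
  re-eq : ∀ a b c d → a *ℤ c - b *ℤ d ≡ a *ℤ c - (- b) *ℤ (- d)
  re-eq = ℤ-Solver.solve-∀
  im-eq : ∀ a b c d → - (a *ℤ d +ℤ b *ℤ c) ≡ a *ℤ (- d) +ℤ (- b) *ℤ c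
  im-eq = ℤ-Solver.solve-∀

*ᵍ-conjʳ : ∀ x → x *ᵍ conj x ≡ ι (norm x)
*ᵍ-conjʳ (a , b) = cong₂ _,_ (re-eq a b) (im-eq a b)
  where
  re-eq : ∀ a b → a *ℤ a - b *ℤ (- b) ≡ a *ℤ a +ℤ b *ℤ b
  re-eq = ℤ-Solver.solve-∀
  im-eq : ∀ a b → a *ℤ (- b) +ℤ b *ℤ a ≡ + 0
  im-eq = ℤ-Solver.solve-∀

*ᵍ-conjˡ : ∀ x → conj x *ᵍ x ≡ ι (norm x)
*ᵍ-conjˡ x = trans (*ᵍ-comm (conj x) x) (*ᵍ-conjʳ x)

norm-*ᵍ : ∀ x y → norm (x *ᵍ y) ≡ norm x *ℤ norm y
norm-*ᵍ (a , b) (c , d) = identity a b c d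
  where
  identity : ∀ a b c d → (a *ℤ c - b *ℤ d) *ℤ (a *ℤ c - b *ℤ d) +ℤ (a *ℤ d +ℤ b *ℤ c) *ℤ (a *ℤ d +ℤ b *ℤ c)
                       ≡ (a *ℤ a +ℤ b *ℤ b) *ℤ (c *ℤ c +ℤ d *ℤ d)
  identity = ℤ-Solver.solve-∀

norm-conj : ∀ x → norm (conj x) ≡ norm x
norm-conj (a , b) = cong (a *ℤ a +ℤ_) (neg-square b)
  where
  neg-square : ∀ b → (- b) *ℤ (- b) ≡ b *ℤ b
  neg-square = ℤ-Solver.solve-∀

norm-*ᵍ-conj : ∀ x c → norm x *ℤ norm c ≡ norm (x *ᵍ conj c)
norm-*ᵍ-conj x c = trans (cong (norm x *ℤ_) (sym (norm-conj c))) (sym (norm-*ᵍ x (conj c)))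

0≤i*i : ∀ i → 0ℤ ≤ i *ℤ i
0≤i*i (+ n)    = subst (0ℤ ≤_) (ℤ.pos-* n n) (+≤+ z≤n)
0≤i*i -[1+ n ] = +≤+ z≤n

0≤norm : ∀ x → 0ℤ ≤ norm x
0≤norm (a , b) = ℤ.+-mono-≤ (0≤i*i a) (0≤i*i b)

nonNeg-sum≡0ˡ : ∀ {i j} → 0ℤ ≤ i → 0ℤ ≤ j → i +ℤ j ≡ 0ℤ → i ≡ 0ℤ
nonNeg-sum≡0ˡ {i} {j} 0≤i 0≤j i+j≡0 =
  ℤ.≤-antisym (subst₂ _≤_ (ℤ.+-identityʳ i) i+j≡0 (ℤ.+-monoʳ-≤ i 0≤j)) 0≤i

norm≡0⇒≡0ᵍ : ∀ x → norm x ≡ 0ℤ → x ≡ 0ᵍ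
norm≡0⇒≡0ᵍ (a , b) a²+b²≡0 = cong₂ _,_ (square≡0⇒≡0 a a²≡0) (square≡0⇒≡0 b b²≡0)
  where
  square≡0⇒≡0 : ∀ i → i *ℤ i ≡ 0ℤ → i ≡ 0ℤ
  square≡0⇒≡0 i i²≡0 = [ id , id ]′ (ℤ.i*j≡0⇒i≡0∨j≡0 i i²≡0)
  a²≡0 : a *ℤ a ≡ 0ℤ
  a²≡0 = nonNeg-sum≡0ˡ (0≤i*i a) (0≤i*i b) a²+b²≡0
  b²≡0 : b *ℤ b ≡ 0ℤ
  b²≡0 = nonNeg-sum≡0ˡ (0≤i*i b) (0≤i*i a) (trans (ℤ.+-comm (b *ℤ b) (a *ℤ a)) a²+b²≡0)

≢0ᵍ⇒0<norm : ∀ x → x ≢ 0ᵍ → 0ℤ < norm x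
≢0ᵍ⇒0<norm x x≢0 = ℤ.≤∧≢⇒< (0≤norm x) (λ 0≡norm → x≢0 (norm≡0⇒≡0ᵍ x (sym 0≡norm)))

x*ᵍy≡0ᵍ⇒x≡0ᵍ∨y≡0ᵍ : ∀ x y → x *ᵍ y ≡ 0ᵍ → x ≡ 0ᵍ ⊎ y ≡ 0ᵍ
x*ᵍy≡0ᵍ⇒x≡0ᵍ∨y≡0ᵍ x y xy≡0 =
  Sum.map (norm≡0⇒≡0ᵍ x) (norm≡0⇒≡0ᵍ y)
    (ℤ.i*j≡0⇒i≡0∨j≡0 (norm x) (trans (sym (norm-*ᵍ x y)) (cong norm xy≡0)))

*ᵍ-≢0ᵍ : ∀ {x y} → x ≢ 0ᵍ → y ≢ 0ᵍ → x *ᵍ y ≢ 0ᵍ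
*ᵍ-≢0ᵍ {x} {y} x≢0 y≢0 xy≡0 = [ x≢0 , y≢0 ]′ (x*ᵍy≡0ᵍ⇒x≡0ᵍ∨y≡0ᵍ x y xy≡0)

conj-≢0ᵍ : ∀ {x} → x ≢ 0ᵍ → conj x ≢ 0ᵍ
conj-≢0ᵍ {x} x≢0 x̄≡0 = x≢0 (trans (sym (conj-involutive x)) (cong conj x̄≡0))

x-ᵍy≡0ᵍ⇒x≡y : ∀ x y → x -ᵍ y ≡ 0ᵍ → x ≡ y
x-ᵍy≡0ᵍ⇒x≡y x y x-y≡0 = trans (sub-add x y) (trans (cong (_+ᵍ y) x-y≡0) (+ᵍ-identityˡ y))
  where
  sub-add : ∀ x y → x ≡ (x -ᵍ y) +ᵍ y
  sub-add = solve-∀ ℤ[i]-ring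

*ᵍ-cancelˡ-≡ : ∀ x y z → x ≢ 0ᵍ → x *ᵍ y ≡ x *ᵍ z → y ≡ z
*ᵍ-cancelˡ-≡ x y z x≢0 xy≡xz = [ ⊥-elim ∘ x≢0 , x-ᵍy≡0ᵍ⇒x≡y y z ]′ (x*ᵍy≡0ᵍ⇒x≡0ᵍ∨y≡0ᵍ x (y -ᵍ z) x[y-z]≡0)
  where
  distrib-sub : ∀ x y z → x *ᵍ (y -ᵍ z) ≡ x *ᵍ y -ᵍ x *ᵍ z
  distrib-sub = solve-∀ ℤ[i]-ring
  sub-self : ∀ u → u -ᵍ u ≡ 0ᵍ
  sub-self = solve-∀ ℤ[i]-ring
  x[y-z]≡0 : x *ᵍ (y -ᵍ z) ≡ 0ᵍ
  x[y-z]≡0 = trans (distrib-sub x y z) (trans (cong (_-ᵍ x *ᵍ z) xy≡xz) (sub-self (x *ᵍ z)))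

conj--ᵍ : ∀ x y → conj (x -ᵍ y) ≡ conj x -ᵍ conj y
conj--ᵍ x y = conj-+ᵍ x (-ᵍ y)

conj-*ᵍ-sub : ∀ x y z t → conj (x *ᵍ y -ᵍ z *ᵍ t) ≡ conj x *ᵍ conj y -ᵍ conj z *ᵍ conj t
conj-*ᵍ-sub x y z t = trans (conj-+ᵍ (x *ᵍ y) (-ᵍ (z *ᵍ t))) (cong₂ (λ p q → p -ᵍ q) (conj-*ᵍ x y) (conj-*ᵍ z t))

∣0ᵍ : ∀ d → d ∣ 0ᵍ
∣0ᵍ d = 0ᵍ , *ᵍ-zeroˡ d

∣-+ᵍ : ∀ {d x y} → d ∣ x → d ∣ y → d ∣ x +ᵍ y
∣-+ᵍ {d} (p , pd≡x) (q , qd≡y) = p +ᵍ q , trans (*ᵍ-distribʳ-+ᵍ d p q) (cong₂ _+ᵍ_ pd≡x qd≡y)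

∣-sumᵍ : ∀ {n d} (f : Fin n → ℤ[i]) → (∀ i → d ∣ f i) → d ∣ sumᵍ f
∣-sumᵍ {zero}  {d} f d∣f = ∣0ᵍ d
∣-sumᵍ {suc n}     f d∣f = ∣-+ᵍ (d∣f zero) (∣-sumᵍ (f ∘ suc) (d∣f ∘ suc))

∣-conj : ∀ {d x} → d ∣ x → conj d ∣ conj x
∣-conj {d} (q , qd≡x) = conj q , trans (sym (conj-*ᵍ q d)) (cong conj qd≡x)

∣-cancelˡ : ∀ {k d x} → k ≢ 0ᵍ → k *ᵍ d ∣ k *ᵍ x → d ∣ x
∣-cancelˡ {k} {d} {x} k≢0 (q , qkd≡kx) = q , *ᵍ-cancelˡ-≡ k (q *ᵍ d) x k≢0 (trans (swap k q d) qkd≡kx)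
  where
  swap : ∀ k q d → k *ᵍ (q *ᵍ d) ≡ q *ᵍ (k *ᵍ d)
  swap = solve-∀ ℤ[i]-ring

quotient : ∀ {d x} → d ∣ x → ℤ[i]
quotient (q , _) = q

quotient-*ᵍ : ∀ {d x} (d∣x : d ∣ x) → quotient d∣x *ᵍ d ≡ x
quotient-*ᵍ (_ , qd≡x) = qd≡x

≤-by-gap : ∀ {i j} gap → 0ℤ ≤ gap → j ≡ i +ℤ gap → i ≤ j
≤-by-gap {i} gap 0≤gap refl = subst (_≤ i +ℤ gap) (ℤ.+-identityʳ i) (ℤ.+-monoʳ-≤ i 0≤gap)

0≤-* : ∀ {i j} → 0ℤ ≤ i → 0ℤ ≤ j → 0ℤ ≤ i *ℤ j
0≤-* {+ m} {+ n} _ _ = subst (0ℤ ≤_) (ℤ.pos-* m n) (+≤+ z≤n)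

-- |r| ≤ D/2, stated without division
record HalfBounded (D r : ℤ) : Set where
  constructor halfBounded
  field
    lower : - D ≤ r +ℤ r
    upper : r +ℤ r ≤ D

halfBounded⇒4r²≤D² : ∀ {D r} → HalfBounded D r → (r +ℤ r) *ℤ (r +ℤ r) ≤ D *ℤ D
halfBounded⇒4r²≤D² {D} {r} (halfBounded -D≤2r 2r≤D) = ≤-by-gap _ (0≤-* (ℤ.i≤j⇒0≤j-i 2r≤D) (ℤ.i≤j⇒0≤j-i -D≤2r)) (identity D (r +ℤ r))
  where
  identity : ∀ D s → D *ℤ D ≡ s *ℤ s +ℤ (D - s) *ℤ (s - - D)
  identity = ℤ-Solver.solve-∀

nearestMultiple : ∀ t D → 0ℤ < D → ∃ λ q → HalfBounded D (t - q *ℤ D)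
nearestMultiple t (+ zero)  (+<+ ())
nearestMultiple t (+ suc n) _ = q , halfBounded lower upper
  where
  D = + suc n
  s = t +ℤ t +ℤ D
  q = s /ℕ (suc n ℕ.+ suc n)
  ρ = s %ℕ (suc n ℕ.+ suc n)
  twice-remainder : (t - q *ℤ D) +ℤ (t - q *ℤ D) ≡ + ρ - D
  twice-remainder = begin
    (t - q *ℤ D) +ℤ (t - q *ℤ D)             ≡⟨ expand t q D ⟩
    s - q *ℤ (D +ℤ D) - D                    ≡⟨ cong (λ x → x - q *ℤ (D +ℤ D) - D) (a≡a%ℕn+[a/ℕn]*n s (suc n ℕ.+ suc n)) ⟩
    + ρ +ℤ q *ℤ (D +ℤ D) - q *ℤ (D +ℤ D) - D ≡⟨ cancel (+ ρ) q D ⟩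
    + ρ - D                                  ∎
    where
    open ≡-Reasoning
    expand : ∀ t q D → (t - q *ℤ D) +ℤ (t - q *ℤ D) ≡ t +ℤ t +ℤ D - q *ℤ (D +ℤ D) - D
    expand = ℤ-Solver.solve-∀
    cancel : ∀ ρ q D → ρ +ℤ q *ℤ (D +ℤ D) - q *ℤ (D +ℤ D) - D ≡ ρ - D
    cancel = ℤ-Solver.solve-∀
  lower : - D ≤ (t - q *ℤ D) +ℤ (t - q *ℤ D)
  lower = ≤-by-gap (+ ρ) (+≤+ z≤n) (trans twice-remainder (ℤ.+-comm (+ ρ) (- D)))
  upper : (t - q *ℤ D) +ℤ (t - q *ℤ D) ≤ D
  upper = ≤-by-gap (D +ℤ D - + ρ) (ℤ.i≤j⇒0≤j-i (+≤+ (ℕ.<⇒≤ (n%ℕd<d s (suc n ℕ.+ suc n)))))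
            (trans (split (+ ρ) D) (cong (_+ℤ (D +ℤ D - + ρ)) (sym twice-remainder)))
    where
    split : ∀ ρ D → D ≡ (ρ - D) +ℤ (D +ℤ D - ρ)
    split = ℤ-Solver.solve-∀

n+n≤d⇒n<d : ∀ {n d} → 0ℤ ≤ n → 0ℤ < d → n +ℤ n ≤ d → n < d
n+n≤d⇒n<d {+ zero}  _ 0<d _   = 0<d
n+n≤d⇒n<d {+ suc m} _ _ 2n≤d = ℤ.<-≤-trans (+<+ (ℕ.m<m+n (suc m) (s≤s z≤n))) 2n≤d

halfBounded-sumSquares⇒< : ∀ {n D e₁ e₂} → 0ℤ ≤ n → 0ℤ < D → HalfBounded D e₁ → HalfBounded D e₂ →
                           n *ℤ D ≡ e₁ *ℤ e₁ +ℤ e₂ *ℤ e₂ → n < D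
halfBounded-sumSquares⇒< {n} {D} {e₁} {e₂} 0≤n 0<D e₁-bounded e₂-bounded nD≡ =
  n+n≤d⇒n<d 0≤n 0<D (ℤ.*-cancelʳ-≤-pos (n +ℤ n) D (D +ℤ D) {{ℤ.positive (ℤ.+-mono-< 0<D 0<D)}} 4nD≤2D²)
  where
  open ℤ.≤-Reasoning
  4nD≤2D² : (n +ℤ n) *ℤ (D +ℤ D) ≤ D *ℤ (D +ℤ D)
  4nD≤2D² = begin
    (n +ℤ n) *ℤ (D +ℤ D)                                 ≡⟨ four-times n D ⟩
    n *ℤ D +ℤ n *ℤ D +ℤ n *ℤ D +ℤ n *ℤ D                 ≡⟨ cong (λ x → x +ℤ x +ℤ x +ℤ x) nD≡ ⟩
    S +ℤ S +ℤ S +ℤ S                                     ≡⟨ regroup e₁ e₂ ⟩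
    (e₁ +ℤ e₁) *ℤ (e₁ +ℤ e₁) +ℤ (e₂ +ℤ e₂) *ℤ (e₂ +ℤ e₂)
      ≤⟨ ℤ.+-mono-≤ (halfBounded⇒4r²≤D² e₁-bounded) (halfBounded⇒4r²≤D² e₂-bounded) ⟩
    D *ℤ D +ℤ D *ℤ D                                     ≡⟨ ℤ.*-distribˡ-+ D D D ⟨
    D *ℤ (D +ℤ D)                                        ∎
    where
    S = e₁ *ℤ e₁ +ℤ e₂ *ℤ e₂
    four-times : ∀ n D → (n +ℤ n) *ℤ (D +ℤ D) ≡ n *ℤ D +ℤ n *ℤ D +ℤ n *ℤ D +ℤ n *ℤ D
    four-times = ℤ-Solver.solve-∀
    regroup : ∀ a b → let S = a *ℤ a +ℤ b *ℤ b in S +ℤ S +ℤ S +ℤ S ≡ (a +ℤ a) *ℤ (a +ℤ a) +ℤ (b +ℤ b) *ℤ (b +ℤ b)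
    regroup = ℤ-Solver.solve-∀

halve-≤ : ∀ {a b} → a +ℤ a ≤ b +ℤ b → a ≤ b
halve-≤ {a} {b} 2a≤2b = ℤ.*-cancelˡ-≤-pos a b (+ 2) (subst₂ _≤_ (double a) (double b) 2a≤2b)
  where
  double : ∀ x → x +ℤ x ≡ + 2 *ℤ x
  double = ℤ-Solver.solve-∀

square-mono-≤ : ∀ {a b} → 0ℤ ≤ a → a ≤ b → a *ℤ a ≤ b *ℤ b
square-mono-≤ {a} {b} 0≤a a≤b = ℤ.≤-trans (ℤ.*-monoˡ-≤-nonNeg a {{ℤ.nonNegative 0≤a}} a≤b)
                                          (ℤ.*-monoʳ-≤-nonNeg b {{ℤ.nonNegative (ℤ.≤-trans 0≤a a≤b)}} a≤b)

square-mono-< : ∀ {a b} → 0ℤ ≤ a → a < b → a *ℤ a < b *ℤ b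
square-mono-< {a} {b} 0≤a a<b = ℤ.≤-<-trans (ℤ.*-monoˡ-≤-nonNeg a {{ℤ.nonNegative 0≤a}} (ℤ.<⇒≤ a<b))
                                            (ℤ.*-monoʳ-<-pos b {{ℤ.positive (ℤ.≤-<-trans 0≤a a<b)}} a<b)

two-squares< : ∀ {X Z D} → 0ℤ ≤ X → X ≤ D → 0ℤ ≤ Z → Z < D → + 2 *ℤ (X *ℤ X +ℤ Z *ℤ Z) < + 4 *ℤ (D *ℤ D)
two-squares< {X} {Z} {D} 0≤X X≤D 0≤Z Z<D =
  subst (+ 2 *ℤ (X *ℤ X +ℤ Z *ℤ Z) <_) (double (D *ℤ D))
    (ℤ.*-monoˡ-<-pos (+ 2) (ℤ.+-mono-≤-< (square-mono-≤ 0≤X X≤D) (square-mono-< 0≤Z Z<D)))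
  where
  double : ∀ s → + 2 *ℤ (s +ℤ s) ≡ + 4 *ℤ s
  double = ℤ-Solver.solve-∀

*ᵍ-ι : ∀ x n → x *ᵍ ι n ≡ (re x *ℤ n , im x *ℤ n)
*ᵍ-ι (a , b) n = cong₂ _,_ (re-eq a b n) (im-eq a b n)
  where
  re-eq : ∀ a b n → a *ℤ n - b *ℤ + 0 ≡ a *ℤ n
  re-eq = ℤ-Solver.solve-∀
  im-eq : ∀ a b n → a *ℤ + 0 +ℤ b *ℤ n ≡ b *ℤ n
  im-eq = ℤ-Solver.solve-∀

euclideanDivision : ∀ a b → b ≢ 0ᵍ → ∃ λ q → norm (a -ᵍ q *ᵍ b) < norm b
euclideanDivision a b b≢0 with nearestMultiple (re (a *ᵍ conj b)) (norm b) (≢0ᵍ⇒0<norm b b≢0)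
                             | nearestMultiple (im (a *ᵍ conj b)) (norm b) (≢0ᵍ⇒0<norm b b≢0)
... | q₁ , e₁-bounded | q₂ , e₂-bounded =
  q , halfBounded-sumSquares⇒< (0≤norm r) (≢0ᵍ⇒0<norm b b≢0) e₁-bounded e₂-bounded norm-r*D
  where
  open ≡-Reasoning
  D = norm b
  T = a *ᵍ conj b
  q = (q₁ , q₂)
  r = a -ᵍ q *ᵍ b
  distrib : ∀ a q b b̄ → (a -ᵍ q *ᵍ b) *ᵍ b̄ ≡ a *ᵍ b̄ -ᵍ q *ᵍ (b *ᵍ b̄)
  distrib = solve-∀ ℤ[i]-ring
  r*b̄ : r *ᵍ conj b ≡ (re T - q₁ *ℤ D , im T - q₂ *ℤ D)
  r*b̄ = begin
    r *ᵍ conj b         ≡⟨ distrib a q b (conj b) ⟩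
    T -ᵍ q *ᵍ (b *ᵍ conj b) ≡⟨ cong (λ x → T -ᵍ q *ᵍ x) (*ᵍ-conjʳ b) ⟩
    T -ᵍ q *ᵍ ι D       ≡⟨ cong (λ x → T -ᵍ x) (*ᵍ-ι q D) ⟩
    (re T - q₁ *ℤ D , im T - q₂ *ℤ D) ∎
  norm-r*D : norm r *ℤ D ≡ (re T - q₁ *ℤ D) *ℤ (re T - q₁ *ℤ D) +ℤ (im T - q₂ *ℤ D) *ℤ (im T - q₂ *ℤ D)
  norm-r*D = trans (norm-*ᵍ-conj r b) (cong norm r*b̄)

_≟ᵍ_ : (x y : ℤ[i]) → Dec (x ≡ y)
_≟ᵍ_ = Product.≡-dec ℤ._≟_ ℤ._≟_

record Bezout₂ (a b : ℤ[i]) : Set where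
  field
    gcd x y : ℤ[i]
    gcd≡    : gcd ≡ x *ᵍ a +ᵍ y *ᵍ b
    gcd∣a   : gcd ∣ a
    gcd∣b   : gcd ∣ b

∣∣-mono-< : ∀ {i j} → 0ℤ ≤ i → i < j → ∣ i ∣ ℕ.< ∣ j ∣
∣∣-mono-< (+≤+ _) (+<+ m<n) = m<n

bezout₂ : ∀ a b → Bezout₂ a b
bezout₂ a b = euclid a b (<-wellFounded ∣ norm b ∣)
  where
  trivial : ∀ a b → a ≡ 1ᵍ *ᵍ a +ᵍ 0ᵍ *ᵍ b
  trivial = solve-∀ ℤ[i]-ring
  shift : ∀ x b y a q → x *ᵍ b +ᵍ y *ᵍ (a -ᵍ q *ᵍ b) ≡ y *ᵍ a +ᵍ (x -ᵍ y *ᵍ q) *ᵍ b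
  shift = solve-∀ ℤ[i]-ring
  reassemble : ∀ a q b → q *ᵍ b +ᵍ (a -ᵍ q *ᵍ b) ≡ a
  reassemble = solve-∀ ℤ[i]-ring
  euclid : ∀ a b → Acc ℕ._<_ ∣ norm b ∣ → Bezout₂ a b
  euclid a b (acc rec) with b ≟ᵍ 0ᵍ
  ... | yes refl = record
    { gcd = a ; x = 1ᵍ ; y = 0ᵍ ; gcd≡ = trivial a 0ᵍ ; gcd∣a = 1ᵍ , *ᵍ-identityˡ a ; gcd∣b = ∣0ᵍ a }
  ... | no b≢0 = step (euclideanDivision a b b≢0)
    where
    step : (∃ λ q → norm (a -ᵍ q *ᵍ b) < norm b) → Bezout₂ a b
    step (q , r<b) = record
      { gcd = gcd ; x = y ; y = x -ᵍ y *ᵍ q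
      ; gcd≡ = trans gcd≡ (shift x b y a q)
      ; gcd∣a = subst (gcd ∣_) (reassemble a q b) (∣-+ᵍ (x∣ʳy⇒x∣ʳzy q gcd∣a) gcd∣b)
      ; gcd∣b = gcd∣a }
      where
      r = a -ᵍ q *ᵍ b
      open Bezout₂ (euclid b r (rec (∣∣-mono-< {norm r} {norm b} (0≤norm r) r<b)))

sumᵍ-cong : ∀ {n} {f g : Fin n → ℤ[i]} → (∀ i → f i ≡ g i) → sumᵍ f ≡ sumᵍ g
sumᵍ-cong {zero}  f≗g = refl
sumᵍ-cong {suc n} f≗g = cong₂ _+ᵍ_ (f≗g zero) (sumᵍ-cong (f≗g ∘ suc))

*ᵍ-sumᵍ : ∀ {n} c (f : Fin n → ℤ[i]) → c *ᵍ sumᵍ f ≡ sumᵍ (λ i → c *ᵍ f i)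
*ᵍ-sumᵍ {zero}  c f = *ᵍ-zeroʳ c
*ᵍ-sumᵍ {suc n} c f = trans (*ᵍ-distribˡ-+ᵍ c (f zero) _) (cong (c *ᵍ f zero +ᵍ_) (*ᵍ-sumᵍ c (f ∘ suc)))

record Bezout {n} (v : Fin n → ℤ[i]) : Set where
  field
    gcd   : ℤ[i]
    coeff : Fin n → ℤ[i]
    gcd≡  : gcd ≡ sumᵍ (λ i → coeff i *ᵍ v i)
    gcd∣  : ∀ i → gcd ∣ v i

bezout : ∀ {n} (v : Fin n → ℤ[i]) → Bezout v
bezout {zero}  v = record { gcd = 0ᵍ ; coeff = λ () ; gcd≡ = refl ; gcd∣ = λ () }
bezout {suc n} v = record
  { gcd = gcd
  ; coeff = x ∷ (λ i → y *ᵍ coeff i)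
  ; gcd≡ = trans gcd≡ (cong (x *ᵍ v zero +ᵍ_) (trans (cong (y *ᵍ_) tail.gcd≡)
             (trans (*ᵍ-sumᵍ y _) (sumᵍ-cong (λ i → sym (*ᵍ-assoc y (coeff i) (v (suc i))))))))
  ; gcd∣ = λ { zero → gcd∣a ; (suc i) → ∣ʳ-trans gcd∣b (tail.gcd∣ i) }
  }
  where
  module tail = Bezout (bezout (v ∘ suc))
  open tail using (coeff)
  open Bezout₂ (bezout₂ (v zero) tail.gcd)

conj-sumᵍ : ∀ {n} (f : Fin n → ℤ[i]) → conj (sumᵍ f) ≡ sumᵍ (conj ∘ f)
conj-sumᵍ {zero}  f = refl
conj-sumᵍ {suc n} f = trans (conj-+ᵍ (f zero) _) (cong (conj (f zero) +ᵍ_) (conj-sumᵍ (f ∘ suc)))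

⋆-conj : ∀ {n} (u v : Vecᵍ n) → v ⋆ u ≡ conj (u ⋆ v)
⋆-conj u v = sym (trans (conj-sumᵍ _) (sumᵍ-cong λ i →
  trans (conj-*ᵍ (conj (u i)) (v i)) (trans (cong (_*ᵍ conj (v i)) (conj-involutive (u i))) (*ᵍ-comm (u i) (conj (v i))))))

sumᵍ-*ᵍ : ∀ {n} (f : Fin n → ℤ[i]) c → sumᵍ f *ᵍ c ≡ sumᵍ (λ i → f i *ᵍ c)
sumᵍ-*ᵍ f c = trans (*ᵍ-comm (sumᵍ f) c) (trans (*ᵍ-sumᵍ c f) (sumᵍ-cong (λ i → *ᵍ-comm c (f i))))

⋆-*ᵍʳ : ∀ {n} (u v : Vecᵍ n) β → u ⋆ (λ i → v i *ᵍ β) ≡ (u ⋆ v) *ᵍ β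
⋆-*ᵍʳ u v β = sym (trans (sumᵍ-*ᵍ _ β) (sumᵍ-cong (λ i → *ᵍ-assoc (conj (u i)) (v i) β)))

⋆-*ᵍ : ∀ {n} (u v : Vecᵍ n) α β → (λ i → u i *ᵍ α) ⋆ (λ i → v i *ᵍ β) ≡ (u ⋆ v) *ᵍ (conj α *ᵍ β)
⋆-*ᵍ u v α β = sym (trans (sumᵍ-*ᵍ _ (conj α *ᵍ β)) (sumᵍ-cong λ i →
  trans (regroup (conj (u i)) (v i) (conj α) β) (cong (_*ᵍ (v i *ᵍ β)) (sym (conj-*ᵍ (u i) α)))))
  where
  regroup : ∀ ū v ᾱ β → ū *ᵍ v *ᵍ (ᾱ *ᵍ β) ≡ ū *ᵍ ᾱ *ᵍ (v *ᵍ β)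
  regroup = solve-∀ ℤ[i]-ring

⋆-cong : ∀ {n} {u u′ v v′ : Vecᵍ n} → (∀ i → u i ≡ u′ i) → (∀ i → v i ≡ v′ i) → u ⋆ v ≡ u′ ⋆ v′
⋆-cong u≗u′ v≗v′ = sumᵍ-cong (λ i → cong₂ (λ x y → conj x *ᵍ y) (u≗u′ i) (v≗v′ i))

⋆-congˡ : ∀ {n} (u : Vecᵍ n) {v v′ : Vecᵍ n} → (∀ i → v i ≡ v′ i) → u ⋆ v ≡ u ⋆ v′
⋆-congˡ u v≗v′ = sumᵍ-cong (λ i → cong (conj (u i) *ᵍ_) (v≗v′ i))

⋆-combinationʳ : ∀ {n} (u p q : Vecᵍ n) α β → u ⋆ (λ i → α *ᵍ p i -ᵍ β *ᵍ q i) ≡ α *ᵍ (u ⋆ p) -ᵍ β *ᵍ (u ⋆ q)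
⋆-combinationʳ {zero}  u p q α β = sym (vanish α β)
  where
  vanish : ∀ α β → α *ᵍ 0ᵍ -ᵍ β *ᵍ 0ᵍ ≡ 0ᵍ
  vanish = solve-∀ ℤ[i]-ring
⋆-combinationʳ {suc n} u p q α β =
  trans (cong (conj (head u) *ᵍ (α *ᵍ head p -ᵍ β *ᵍ head q) +ᵍ_) (⋆-combinationʳ (tail u) (tail p) (tail q) α β))
        (regroup (conj (head u)) (head p) (head q) α β (tail u ⋆ tail p) (tail u ⋆ tail q))
  where
  regroup : ∀ ū p q α β s t → ū *ᵍ (α *ᵍ p -ᵍ β *ᵍ q) +ᵍ (α *ᵍ s -ᵍ β *ᵍ t) ≡ α *ᵍ (ū *ᵍ p +ᵍ s) -ᵍ β *ᵍ (ū *ᵍ q +ᵍ t)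
  regroup = solve-∀ ℤ[i]-ring

⋆-combinationˡ : ∀ {n} (u p q : Vecᵍ n) α β → (λ i → α *ᵍ p i -ᵍ β *ᵍ q i) ⋆ u ≡ conj α *ᵍ (p ⋆ u) -ᵍ conj β *ᵍ (q ⋆ u)
⋆-combinationˡ u p q α β = begin
  (λ i → α *ᵍ p i -ᵍ β *ᵍ q i) ⋆ u                ≡⟨ ⋆-conj u (λ i → α *ᵍ p i -ᵍ β *ᵍ q i) ⟩
  conj (u ⋆ (λ i → α *ᵍ p i -ᵍ β *ᵍ q i))         ≡⟨ cong conj (⋆-combinationʳ u p q α β) ⟩
  conj (α *ᵍ (u ⋆ p) -ᵍ β *ᵍ (u ⋆ q))             ≡⟨ conj-*ᵍ-sub α (u ⋆ p) β (u ⋆ q) ⟩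
  conj α *ᵍ conj (u ⋆ p) -ᵍ conj β *ᵍ conj (u ⋆ q) ≡⟨ cong₂ (λ x y → conj α *ᵍ x -ᵍ conj β *ᵍ y) (⋆-conj u p) (⋆-conj u q) ⟨
  conj α *ᵍ (p ⋆ u) -ᵍ conj β *ᵍ (q ⋆ u)           ∎
  where open ≡-Reasoning

import Tactic.RingSolver.NonReflective ℤ[i]-ring as Solver

module Vector3 (R : RawRing 0ℓ 0ℓ) where
  open RawRing R public using (Carrier; 0#; 1#)
    renaming (_+_ to infixl 6 _⊕_; _*_ to infixl 7 _⊗_; -_ to infix 8 ⊝_)

  infixl 6 _⊖_

  _⊖_ : Carrier → Carrier → Carrier
  x ⊖ y = x ⊕ ⊝ y

  dot : ∀ {n} → (Fin n → Carrier) → (Fin n → Carrier) → Carrier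
  dot {zero}  u v = 0#
  dot {suc n} u v = u zero ⊗ v zero ⊕ dot (u ∘ suc) (v ∘ suc)

  cross : (Fin 3 → Carrier) → (Fin 3 → Carrier) → Fin 3 → Carrier
  cross u v zero             = u (# 1) ⊗ v (# 2) ⊖ u (# 2) ⊗ v (# 1)
  cross u v (suc zero)       = u (# 2) ⊗ v (# 0) ⊖ u (# 0) ⊗ v (# 2)
  cross u v (suc (suc zero)) = u (# 0) ⊗ v (# 1) ⊖ u (# 1) ⊗ v (# 0)

  kronecker : Fin 3 → Fin 3 → Carrier
  kronecker i j = if does (i Fin.≟ j) then 1# else 0#

  binetCauchyExpansion : (A B a b : Fin 3 → Carrier) → Fin 3 → Fin 3 → Carrier
  binetCauchyExpansion A B a b i j =
    kronecker i j ⊗ (dot A a ⊗ dot B b ⊖ dot A b ⊗ dot B a)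
    ⊖ a i ⊗ (A j ⊗ dot B b ⊖ dot A b ⊗ B j)
    ⊕ b i ⊗ (A j ⊗ dot B a ⊖ dot A a ⊗ B j)

open Vector3 (CommutativeRing.rawRing ℤ[i]-commutativeRing) public
  using (dot; cross; kronecker; binetCauchyExpansion)

-- Identities between polynomials in the twelve coordinates of A, B, a, b are checked by
-- normalising the same expressions built over the solver's symbolic ring.
private
  symbolicRing : RawRing 0ℓ 0ℓ
  symbolicRing = record
    { Carrier = Solver.Expr ℤ[i] 12 ; _≈_ = _≡_
    ; _+_ = Solver._⊕_ ; _*_ = Solver._⊗_ ; -_ = Solver.⊝_ ; 0# = Solver.Κ 0ᵍ ; 1# = Solver.Κ 1ᵍ }

  module S = Vector3 symbolicRing

  Aₛ Bₛ aₛ bₛ : Fin 3 → Solver.Expr ℤ[i] 12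
  Aₛ i = Solver.Ι (i ↑ˡ 9)
  Bₛ i = Solver.Ι (3 ↑ʳ (i ↑ˡ 6))
  aₛ i = Solver.Ι (6 ↑ʳ (i ↑ˡ 3))
  bₛ i = Solver.Ι (9 ↑ʳ i)

  env : (A B a b : Vecᵍ 3) → Vec ℤ[i] 12
  env A B a b = toVec (A (# 0) ∷ A (# 1) ∷ A (# 2) ∷ B (# 0) ∷ B (# 1) ∷ B (# 2)
                     ∷ a (# 0) ∷ a (# 1) ∷ a (# 2) ∷ b (# 0) ∷ b (# 1) ∷ b (# 2) ∷ [])

  lhsₛ rhsₛ : Fin 3 → Fin 3 → Solver.Expr ℤ[i] 12
  lhsₛ i j = S.cross Aₛ Bₛ i S.⊗ S.cross aₛ bₛ j
  rhsₛ i j = S.binetCauchyExpansion Aₛ Bₛ aₛ bₛ i j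

  open Solver.Ops using (prove)

dot-cross-self : ∀ A B → dot A (cross A B) ≡ 0ᵍ × dot B (cross A B) ≡ 0ᵍ
dot-cross-self A B = prove (env A B A B) (S.dot Aₛ (S.cross Aₛ Bₛ)) (Solver.Κ 0ᵍ) refl
                   , prove (env A B A B) (S.dot Bₛ (S.cross Aₛ Bₛ)) (Solver.Κ 0ᵍ) refl

lagrange : ∀ A B a b → dot (cross A B) (cross a b) ≡ dot A a *ᵍ dot B b -ᵍ dot A b *ᵍ dot B a
lagrange A B a b = prove (env A B a b) (S.dot (S.cross Aₛ Bₛ) (S.cross aₛ bₛ))
                     (S.dot Aₛ aₛ S.⊗ S.dot Bₛ bₛ S.⊖ S.dot Aₛ bₛ S.⊗ S.dot Bₛ aₛ) refl

binetCauchy : ∀ A B a b i j → cross A B i *ᵍ cross a b j ≡ binetCauchyExpansion A B a b i j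
binetCauchy A B a b i@zero j@zero = prove (env A B a b) (lhsₛ i j) (rhsₛ i j) refl
binetCauchy A B a b i@zero j@(suc zero) = prove (env A B a b) (lhsₛ i j) (rhsₛ i j) refl
binetCauchy A B a b i@zero j@(suc (suc zero)) = prove (env A B a b) (lhsₛ i j) (rhsₛ i j) refl
binetCauchy A B a b i@(suc zero) j@zero = prove (env A B a b) (lhsₛ i j) (rhsₛ i j) refl
binetCauchy A B a b i@(suc zero) j@(suc zero) = prove (env A B a b) (lhsₛ i j) (rhsₛ i j) refl
binetCauchy A B a b i@(suc zero) j@(suc (suc zero)) = prove (env A B a b) (lhsₛ i j) (rhsₛ i j) refl
binetCauchy A B a b i@(suc (suc zero)) j@zero = prove (env A B a b) (lhsₛ i j) (rhsₛ i j) refl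
binetCauchy A B a b i@(suc (suc zero)) j@(suc zero) = prove (env A B a b) (lhsₛ i j) (rhsₛ i j) refl
binetCauchy A B a b i@(suc (suc zero)) j@(suc (suc zero)) = prove (env A B a b) (lhsₛ i j) (rhsₛ i j) refl

conj-*ᵍ-sub-conj : ∀ x y z t → conj (conj x *ᵍ conj y -ᵍ conj z *ᵍ conj t) ≡ x *ᵍ y -ᵍ z *ᵍ t
conj-*ᵍ-sub-conj x y z t = trans (conj-*ᵍ-sub (conj x) (conj y) (conj z) (conj t))
  (cong₂ (λ p q → p -ᵍ q) (cong₂ _*ᵍ_ (conj-involutive x) (conj-involutive y)) (cong₂ _*ᵍ_ (conj-involutive z) (conj-involutive t)))

conj-cross-conj : ∀ u v i → conj (cross (conj ∘ u) (conj ∘ v) i) ≡ cross u v i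
conj-cross-conj u v zero             = conj-*ᵍ-sub-conj (u (# 1)) (v (# 2)) (u (# 2)) (v (# 1))
conj-cross-conj u v (suc zero)       = conj-*ᵍ-sub-conj (u (# 2)) (v (# 0)) (u (# 0)) (v (# 2))
conj-cross-conj u v (suc (suc zero)) = conj-*ᵍ-sub-conj (u (# 0)) (v (# 1)) (u (# 1)) (v (# 0))

-- Completing an orthogonal pair

hermitianCross : Vecᵍ 3 → Vecᵍ 3 → Vecᵍ 3
hermitianCross a b = cross (conj ∘ a) (conj ∘ b)

⋆-hermitianCross : ∀ a b → a ⋆ hermitianCross a b ≡ 0ᵍ × b ⋆ hermitianCross a b ≡ 0ᵍ
⋆-hermitianCross a b = dot-cross-self (conj ∘ a) (conj ∘ b)

hermitianCross-⋆-self : ∀ a b → hermitianCross a b ⋆ hermitianCross a b ≡ (a ⋆ a) *ᵍ (b ⋆ b) -ᵍ (a ⋆ b) *ᵍ (b ⋆ a)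
hermitianCross-⋆-self a b = trans
  (sumᵍ-cong (λ i → trans (cong (_*ᵍ w i) (conj-cross-conj a b i)) (*ᵍ-comm (cross a b i) (w i))))
  (lagrange (conj ∘ a) (conj ∘ b) a b)
  where w = hermitianCross a b

hermitianCross-outer : ∀ {L} a b → a ⋆ a ≡ L → b ⋆ b ≡ L → a ⋆ b ≡ 0ᵍ → ∀ i j →
  (kronecker i j *ᵍ L -ᵍ a i *ᵍ conj (a j) -ᵍ b i *ᵍ conj (b j)) *ᵍ L ≡ hermitianCross a b i *ᵍ conj (hermitianCross a b j)
hermitianCross-outer {L} a b a⋆a b⋆b a⋆b i j = sym (begin
  hermitianCross a b i *ᵍ conj (hermitianCross a b j) ≡⟨ cong (hermitianCross a b i *ᵍ_) (conj-cross-conj a b j) ⟩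
  cross (conj ∘ a) (conj ∘ b) i *ᵍ cross a b j        ≡⟨ binetCauchy (conj ∘ a) (conj ∘ b) a b i j ⟩
  expansion (a ⋆ a) (b ⋆ b) (a ⋆ b) (b ⋆ a)           ≡⟨ cong₂ (λ Aa Bb → expansion Aa Bb (a ⋆ b) (b ⋆ a)) a⋆a b⋆b ⟩
  expansion L L (a ⋆ b) (b ⋆ a)                       ≡⟨ cong₂ (expansion L L) a⋆b b⋆a ⟩
  expansion L L 0ᵍ 0ᵍ                                 ≡⟨ specialise (kronecker i j) L (a i) (conj (a j)) (b i) (conj (b j)) ⟩
  (kronecker i j *ᵍ L -ᵍ a i *ᵍ conj (a j) -ᵍ b i *ᵍ conj (b j)) *ᵍ L ∎)
  where
  open ≡-Reasoning
  b⋆a : b ⋆ a ≡ 0ᵍ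
  b⋆a = trans (⋆-conj a b) (cong conj a⋆b)
  expansion : ℤ[i] → ℤ[i] → ℤ[i] → ℤ[i] → ℤ[i]
  expansion Aa Bb Ab Ba = kronecker i j *ᵍ (Aa *ᵍ Bb -ᵍ Ab *ᵍ Ba)
                        -ᵍ a i *ᵍ (conj (a j) *ᵍ Bb -ᵍ Ab *ᵍ conj (b j))
                        +ᵍ b i *ᵍ (conj (a j) *ᵍ Ba -ᵍ Aa *ᵍ conj (b j))
  specialise : ∀ δ L aᵢ āⱼ bᵢ b̄ⱼ →
    δ *ᵍ (L *ᵍ L -ᵍ 0ᵍ *ᵍ 0ᵍ) -ᵍ aᵢ *ᵍ (āⱼ *ᵍ L -ᵍ 0ᵍ *ᵍ b̄ⱼ) +ᵍ bᵢ *ᵍ (āⱼ *ᵍ 0ᵍ -ᵍ L *ᵍ b̄ⱼ)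
      ≡ (δ *ᵍ L -ᵍ aᵢ *ᵍ āⱼ -ᵍ bᵢ *ᵍ b̄ⱼ) *ᵍ L
  specialise = solve-∀ ℤ[i]-ring

∣-unimodular : ∀ {n m v} (x u : Fin n → ℤ[i]) → sumᵍ (λ k → x k *ᵍ u k) ≡ 1ᵍ →
               (∀ k → m ∣ u k *ᵍ v) → m ∣ v
∣-unimodular {m = m} {v} x u Σxu≡1 m∣uv =
  subst (m ∣_) v≡Σ (∣-sumᵍ _ (λ k → x∣ʳy⇒x∣ʳzy (x k) (m∣uv k)))
  where
  open ≡-Reasoning
  rotate : ∀ x u v → v *ᵍ (x *ᵍ u) ≡ x *ᵍ (u *ᵍ v)
  rotate = solve-∀ ℤ[i]-ring
  v≡Σ : sumᵍ (λ k → x k *ᵍ (u k *ᵍ v)) ≡ v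
  v≡Σ = begin
    sumᵍ (λ k → x k *ᵍ (u k *ᵍ v))  ≡⟨ sumᵍ-cong (λ k → rotate (x k) (u k) v) ⟨
    sumᵍ (λ k → v *ᵍ (x k *ᵍ u k))  ≡⟨ *ᵍ-sumᵍ v _ ⟨
    v *ᵍ sumᵍ (λ k → x k *ᵍ u k)    ≡⟨ cong (v *ᵍ_) Σxu≡1 ⟩
    v *ᵍ 1ᵍ                         ≡⟨ *ᵍ-identityʳ v ⟩
    v                               ∎

cofactors-unimodular : ∀ {n} g (x v v′ : Fin n → ℤ[i]) → g ≢ 0ᵍ → g ≡ sumᵍ (λ k → x k *ᵍ v k) →
                       (∀ k → v′ k *ᵍ g ≡ v k) → sumᵍ (λ k → x k *ᵍ v′ k) ≡ 1ᵍ
cofactors-unimodular g x v v′ g≢0 g≡Σxv v′g≡v = *ᵍ-cancelˡ-≡ g (sumᵍ (λ k → x k *ᵍ v′ k)) 1ᵍ g≢0 (begin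
  g *ᵍ sumᵍ (λ k → x k *ᵍ v′ k)      ≡⟨ *ᵍ-sumᵍ g (λ k → x k *ᵍ v′ k) ⟩
  sumᵍ (λ k → g *ᵍ (x k *ᵍ v′ k))    ≡⟨ sumᵍ-cong (λ k → trans (swap g (x k) (v′ k)) (cong (x k *ᵍ_) (v′g≡v k))) ⟩
  sumᵍ (λ k → x k *ᵍ v k)            ≡⟨ g≡Σxv ⟨
  g                                  ≡⟨ *ᵍ-identityʳ g ⟨
  g *ᵍ 1ᵍ                            ∎)
  where
  open ≡-Reasoning
  swap : ∀ g x v → g *ᵍ (x *ᵍ v) ≡ x *ᵍ (v *ᵍ g)
  swap = solve-∀ ℤ[i]-ring

*ᵍ-conj-factor : ∀ p q d → (p *ᵍ d) *ᵍ conj (q *ᵍ d) ≡ (d *ᵍ conj d) *ᵍ (p *ᵍ conj q)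
*ᵍ-conj-factor p q d = trans (cong ((p *ᵍ d) *ᵍ_) (conj-*ᵍ q d)) (regroup p d (conj q) (conj d))
  where
  regroup : ∀ p d q̄ d̄ → (p *ᵍ d) *ᵍ (q̄ *ᵍ d̄) ≡ (d *ᵍ d̄) *ᵍ (p *ᵍ q̄)
  regroup = solve-∀ ℤ[i]-ring

-- With g = gcd(c, w₁, …, wₙ), c = c′ g and w = w′ g, the vector (c′, w′) is unimodular,
-- so c′ c̄′ ∣ w′ᵢ w̄′ⱼ forces c′ ∣ w̄′ⱼ; hence σ = c̄′ g divides w and σ σ̄ = c c̄.
commonDivisorOfNorm : ∀ {n} c (w : Fin n → ℤ[i]) → c ≢ 0ᵍ →
                      (∀ i j → c *ᵍ conj c ∣ w i *ᵍ conj (w j)) →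
                      ∃ λ σ → σ *ᵍ conj σ ≡ c *ᵍ conj c × (∀ i → σ ∣ w i)
commonDivisorOfNorm {n} c w c≢0 cc̄∣ww̄ = conj c′ *ᵍ gcd , σσ̄≡cc̄ , σ∣w
  where
  open ≡-Reasoning
  open Bezout (bezout (c ∷ w))
  v : Fin (suc n) → ℤ[i]
  v = c ∷ w
  v′ : Fin (suc n) → ℤ[i]
  v′ k = quotient (gcd∣ k)
  v′*gcd≡v : ∀ k → v′ k *ᵍ gcd ≡ v k
  v′*gcd≡v k = quotient-*ᵍ (gcd∣ k)
  c′ = v′ zero
  w′ = v′ ∘ suc
  gcd≢0 : gcd ≢ 0ᵍ
  gcd≢0 gcd≡0 = c≢0 (trans (sym (v′*gcd≡v zero)) (trans (cong (c′ *ᵍ_) gcd≡0) (*ᵍ-zeroʳ c′)))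
  v′-unimodular : sumᵍ (λ k → coeff k *ᵍ v′ k) ≡ 1ᵍ
  v′-unimodular = cofactors-unimodular gcd coeff v v′ gcd≢0 gcd≡ v′*gcd≡v
  outer : ∀ k l → v k *ᵍ conj (v l) ≡ (gcd *ᵍ conj gcd) *ᵍ (v′ k *ᵍ conj (v′ l))
  outer k l = trans (cong₂ (λ x y → x *ᵍ conj y) (sym (v′*gcd≡v k)) (sym (v′*gcd≡v l))) (*ᵍ-conj-factor (v′ k) (v′ l) gcd)
  c′c̄′∣w′w̄′ : ∀ i j → c′ *ᵍ conj c′ ∣ w′ i *ᵍ conj (w′ j)
  c′c̄′∣w′w̄′ i j = ∣-cancelˡ (*ᵍ-≢0ᵍ gcd≢0 (conj-≢0ᵍ gcd≢0))
    (subst₂ _∣_ (outer zero zero) (outer (suc i) (suc j)) (cc̄∣ww̄ i j))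
  c′∣w̄′ : ∀ j → c′ ∣ conj (w′ j)
  c′∣w̄′ j = ∣-unimodular coeff v′ v′-unimodular λ
    { zero    → x∣xy c′ (conj (w′ j))
    ; (suc i) → ∣ʳ-trans (x∣xy c′ (conj c′)) (c′c̄′∣w′w̄′ i j) }
  σ∣w : ∀ j → conj c′ *ᵍ gcd ∣ w j
  σ∣w j = subst (conj c′ *ᵍ gcd ∣_) (v′*gcd≡v (suc j))
    (∙-cong-∣ (subst (conj c′ ∣_) (conj-involutive (w′ j)) (∣-conj (c′∣w̄′ j))) (1ᵍ , *ᵍ-identityˡ gcd))
  σσ̄≡cc̄ : (conj c′ *ᵍ gcd) *ᵍ conj (conj c′ *ᵍ gcd) ≡ c *ᵍ conj c
  σσ̄≡cc̄ = begin
    (conj c′ *ᵍ gcd) *ᵍ conj (conj c′ *ᵍ gcd)  ≡⟨ *ᵍ-conj-factor (conj c′) (conj c′) gcd ⟩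
    (gcd *ᵍ conj gcd) *ᵍ (conj c′ *ᵍ conj (conj c′)) ≡⟨ cong (λ x → (gcd *ᵍ conj gcd) *ᵍ (conj c′ *ᵍ x)) (conj-involutive c′) ⟩
    (gcd *ᵍ conj gcd) *ᵍ (conj c′ *ᵍ c′)       ≡⟨ cong ((gcd *ᵍ conj gcd) *ᵍ_) (*ᵍ-comm (conj c′) c′) ⟩
    (gcd *ᵍ conj gcd) *ᵍ (c′ *ᵍ conj c′)       ≡⟨ outer zero zero ⟨
    c *ᵍ conj c                                ∎

⋆-zero-scaled : ∀ {n} (u s : Vecᵍ n) σ → σ ≢ 0ᵍ → u ⋆ (λ i → s i *ᵍ σ) ≡ 0ᵍ → u ⋆ s ≡ 0ᵍ
⋆-zero-scaled u s σ σ≢0 u⋆sσ≡0 = [ id , ⊥-elim ∘ σ≢0 ]′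
  (x*ᵍy≡0ᵍ⇒x≡0ᵍ∨y≡0ᵍ (u ⋆ s) σ (trans (sym (⋆-*ᵍʳ u s σ)) u⋆sσ≡0))

⋆-self-scaled : ∀ {n} (s : Vecᵍ n) σ L → L ≢ 0ᵍ → σ *ᵍ conj σ ≡ L →
                (λ i → s i *ᵍ σ) ⋆ (λ i → s i *ᵍ σ) ≡ L *ᵍ L → s ⋆ s ≡ L
⋆-self-scaled s σ L L≢0 σσ̄≡L sσ⋆sσ≡L² = *ᵍ-cancelˡ-≡ L (s ⋆ s) L L≢0 (begin
  L *ᵍ (s ⋆ s)                          ≡⟨ *ᵍ-comm L (s ⋆ s) ⟩
  (s ⋆ s) *ᵍ L                          ≡⟨ cong ((s ⋆ s) *ᵍ_) (trans (*ᵍ-comm (conj σ) σ) σσ̄≡L) ⟨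
  (s ⋆ s) *ᵍ (conj σ *ᵍ σ)              ≡⟨ ⋆-*ᵍ s s σ σ ⟨
  (λ i → s i *ᵍ σ) ⋆ (λ i → s i *ᵍ σ)   ≡⟨ sσ⋆sσ≡L² ⟩
  L *ᵍ L                                ∎)
  where open ≡-Reasoning

thirdColumn : ∀ c (a b : Vecᵍ 3) → c ≢ 0ᵍ → a ⋆ a ≡ c *ᵍ conj c → b ⋆ b ≡ c *ᵍ conj c → a ⋆ b ≡ 0ᵍ →
              ∃ λ s → s ⋆ s ≡ c *ᵍ conj c × a ⋆ s ≡ 0ᵍ × b ⋆ s ≡ 0ᵍ
thirdColumn c a b c≢0 a⋆a b⋆b a⋆b = divideOut (commonDivisorOfNorm c w c≢0 L∣ww̄)
  where
  L = c *ᵍ conj c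
  L≢0 : L ≢ 0ᵍ
  L≢0 = *ᵍ-≢0ᵍ c≢0 (conj-≢0ᵍ c≢0)
  w = hermitianCross a b
  L∣ww̄ : ∀ i j → L ∣ w i *ᵍ conj (w j)
  L∣ww̄ i j = kronecker i j *ᵍ L -ᵍ a i *ᵍ conj (a j) -ᵍ b i *ᵍ conj (b j) , hermitianCross-outer a b a⋆a b⋆b a⋆b i j
  w⋆w≡L² : w ⋆ w ≡ L *ᵍ L
  w⋆w≡L² = trans (hermitianCross-⋆-self a b) (begin
    (a ⋆ a) *ᵍ (b ⋆ b) -ᵍ (a ⋆ b) *ᵍ (b ⋆ a) ≡⟨ cong₂ (λ x y → x *ᵍ y -ᵍ (a ⋆ b) *ᵍ (b ⋆ a)) a⋆a b⋆b ⟩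
    L *ᵍ L -ᵍ (a ⋆ b) *ᵍ (b ⋆ a)             ≡⟨ cong (λ x → L *ᵍ L -ᵍ x *ᵍ (b ⋆ a)) a⋆b ⟩
    L *ᵍ L -ᵍ 0ᵍ *ᵍ (b ⋆ a)                  ≡⟨ drop-zero (L *ᵍ L) (b ⋆ a) ⟩
    L *ᵍ L                                   ∎)
    where
    open ≡-Reasoning
    drop-zero : ∀ x y → x -ᵍ 0ᵍ *ᵍ y ≡ x
    drop-zero = solve-∀ ℤ[i]-ring
  divideOut : (∃ λ σ → σ *ᵍ conj σ ≡ L × (∀ i → σ ∣ w i)) → ∃ λ s → s ⋆ s ≡ L × a ⋆ s ≡ 0ᵍ × b ⋆ s ≡ 0ᵍ
  divideOut (σ , σσ̄≡L , σ∣w) =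
    s , ⋆-self-scaled s σ L L≢0 σσ̄≡L (trans (⋆-cong {u = sσ} {w} {sσ} {w} sσ≡w sσ≡w) w⋆w≡L²)
      , ⋆-zero-scaled a s σ σ≢0 (trans (⋆-congˡ a sσ≡w) (proj₁ (⋆-hermitianCross a b)))
      , ⋆-zero-scaled b s σ σ≢0 (trans (⋆-congˡ b sσ≡w) (proj₂ (⋆-hermitianCross a b)))
    where
    s sσ : Vecᵍ 3
    s i = quotient (σ∣w i)
    sσ i = s i *ᵍ σ
    sσ≡w : ∀ i → sσ i ≡ w i
    sσ≡w i = quotient-*ᵍ (σ∣w i)
    σ≢0 : σ ≢ 0ᵍ
    σ≢0 σ≡0 = L≢0 (trans (sym σσ̄≡L) (trans (cong (_*ᵍ conj σ) σ≡0) (*ᵍ-zeroˡ (conj σ))))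

-- Approximation by points of the D₄ lattice

Even Odd : ℤ → Set
Even n = ∃ λ h → n ≡ h +ℤ h
Odd  n = ∃ λ h → n ≡ h +ℤ h +ℤ + 1

even-or-odd : ∀ n → Even n ⊎ Odd n
even-or-odd n = by-remainder (n %ℕ 2) (a≡a%ℕn+[a/ℕn]*n n 2) (n%ℕd<d n 2)
  where
  h = n /ℕ 2
  by-remainder : ∀ ρ → n ≡ + ρ +ℤ h *ℤ + 2 → ρ ℕ.< 2 → Even n ⊎ Odd n
  by-remainder 0 n≡ _ = inj₁ (h , trans n≡ (double h))
    where
    double : ∀ h → + 0 +ℤ h *ℤ + 2 ≡ h +ℤ h
    double = ℤ-Solver.solve-∀
  by-remainder 1 n≡ _ = inj₂ (h , trans n≡ (double+1 h))
    where
    double+1 : ∀ h → + 1 +ℤ h *ℤ + 2 ≡ h +ℤ h +ℤ + 1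
    double+1 = ℤ-Solver.solve-∀
  by-remainder (suc (suc _)) _ (s≤s (s≤s ()))

sq : ℤ → ℤ
sq x = x *ℤ x

flip-rounding : ∀ t q D → HalfBounded D (t - q *ℤ D) →
                ∃ λ q′ → (∀ Q → Odd (sq q +ℤ Q) → Even (sq q′ +ℤ Q))
                       × sq (t - q′ *ℤ D) +ℤ + 3 *ℤ sq (t - q *ℤ D) ≤ D *ℤ D
flip-rounding t q D (halfBounded -D≤2r 2r≤D) with 0ℤ ≤? t - q *ℤ D
... | yes 0≤r = q +ℤ + 1 , parity , ≤-by-gap _ (0≤-* (ℤ.+-mono-≤ 0≤r 0≤r) (ℤ.i≤j⇒0≤j-i 2r≤D)) (gap t q D)
  where
  parity : ∀ Q → Odd (sq q +ℤ Q) → Even (sq (q +ℤ + 1) +ℤ Q)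
  parity Q (h , q²+Q≡) = h +ℤ q +ℤ + 1 , trans (expand q Q) (trans (cong (_+ℤ (q +ℤ q +ℤ + 1)) q²+Q≡) (regroup h q))
    where
    expand : ∀ q Q → (q +ℤ + 1) *ℤ (q +ℤ + 1) +ℤ Q ≡ (q *ℤ q +ℤ Q) +ℤ (q +ℤ q +ℤ + 1)
    expand = ℤ-Solver.solve-∀
    regroup : ∀ h q → h +ℤ h +ℤ + 1 +ℤ (q +ℤ q +ℤ + 1) ≡ (h +ℤ q +ℤ + 1) +ℤ (h +ℤ q +ℤ + 1)
    regroup = ℤ-Solver.solve-∀
  gap : ∀ t q D → let r = t - q *ℤ D in
        D *ℤ D ≡ (t - (q +ℤ + 1) *ℤ D) *ℤ (t - (q +ℤ + 1) *ℤ D) +ℤ + 3 *ℤ (r *ℤ r) +ℤ (r +ℤ r) *ℤ (D - (r +ℤ r))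
  gap = ℤ-Solver.solve-∀
... | no  0≰r = q - + 1 , parity , ≤-by-gap _ (0≤-* -2r≥0 (ℤ.i≤j⇒0≤j-i -D≤2r)) (gap t q D)
  where
  r≤0 : t - q *ℤ D ≤ 0ℤ
  r≤0 = ℤ.<⇒≤ (ℤ.≰⇒> 0≰r)
  -2r≥0 : 0ℤ ≤ - ((t - q *ℤ D) +ℤ (t - q *ℤ D))
  -2r≥0 = ℤ.neg-mono-≤ (ℤ.+-mono-≤ r≤0 r≤0)
  parity : ∀ Q → Odd (sq q +ℤ Q) → Even (sq (q - + 1) +ℤ Q)
  parity Q (h , q²+Q≡) = h - q +ℤ + 1 , trans (expand q Q) (trans (cong (_+ℤ (+ 1 - (q +ℤ q))) q²+Q≡) (regroup h q))
    where
    expand : ∀ q Q → (q - + 1) *ℤ (q - + 1) +ℤ Q ≡ (q *ℤ q +ℤ Q) +ℤ (+ 1 - (q +ℤ q))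
    expand = ℤ-Solver.solve-∀
    regroup : ∀ h q → h +ℤ h +ℤ + 1 +ℤ (+ 1 - (q +ℤ q)) ≡ (h - q +ℤ + 1) +ℤ (h - q +ℤ + 1)
    regroup = ℤ-Solver.solve-∀
  gap : ∀ t q D → let r = t - q *ℤ D in
        D *ℤ D ≡ (t - (q - + 1) *ℤ D) *ℤ (t - (q - + 1) *ℤ D) +ℤ + 3 *ℤ (r *ℤ r) +ℤ (- (r +ℤ r)) *ℤ ((r +ℤ r) - - D)
  gap = ℤ-Solver.solve-∀

flip-into : ∀ t q D O Q → HalfBounded D (t - q *ℤ D) → sq (t - q *ℤ D) +ℤ O ≤ + 4 *ℤ sq (t - q *ℤ D) →
            Odd (sq q +ℤ Q) → ∃ λ q′ → Even (sq q′ +ℤ Q) × sq (t - q′ *ℤ D) +ℤ O ≤ D *ℤ D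
flip-into t q D O Q bounded r²+O≤4r² odd with flip-rounding t q D bounded
... | q′ , parity , r′²+3r²≤D² = q′ , parity Q odd , ℤ.≤-trans (ℤ.+-monoʳ-≤ (sq (t - q′ *ℤ D)) O≤3r²) r′²+3r²≤D²
  where
  O≤3r² : O ≤ + 3 *ℤ sq (t - q *ℤ D)
  O≤3r² = ℤ.0≤i-j⇒j≤i (subst (0ℤ ≤_) (same-gap (t - q *ℤ D) O) (ℤ.i≤j⇒0≤j-i r²+O≤4r²))
    where
    same-gap : ∀ r O → + 4 *ℤ (r *ℤ r) - (r *ℤ r +ℤ O) ≡ + 3 *ℤ (r *ℤ r) - O
    same-gap = ℤ-Solver.solve-∀

record EvenApproximation (t₁ t₂ t₃ t₄ D : ℤ) : Set where
  constructor evenApproximation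
  field
    q₁ q₂ q₃ q₄ : ℤ
    even  : Even (sq q₁ +ℤ sq q₂ +ℤ sq q₃ +ℤ sq q₄)
    close : sq (t₁ - q₁ *ℤ D) +ℤ sq (t₂ - q₂ *ℤ D) +ℤ sq (t₃ - q₃ *ℤ D) +ℤ sq (t₄ - q₄ *ℤ D) ≤ D *ℤ D

private
  move₁ : ∀ a b c d → a +ℤ b +ℤ c +ℤ d ≡ a +ℤ (b +ℤ c +ℤ d)
  move₁ = ℤ-Solver.solve-∀
  move₂ : ∀ a b c d → a +ℤ b +ℤ c +ℤ d ≡ b +ℤ (a +ℤ c +ℤ d)
  move₂ = ℤ-Solver.solve-∀
  move₃ : ∀ a b c d → a +ℤ b +ℤ c +ℤ d ≡ c +ℤ (a +ℤ b +ℤ d)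
  move₃ = ℤ-Solver.solve-∀
  move₄ : ∀ a b c d → a +ℤ b +ℤ c +ℤ d ≡ d +ℤ (a +ℤ b +ℤ c)
  move₄ = ℤ-Solver.solve-∀

-- If Σ qᵢ² is odd, moving the coordinate with
-- the largest error to its other neighbouring multiple fixes the parity and keeps the total
-- squared error within D² (the covering radius of the D₄ lattice is 1).
evenApproximation₄ : ∀ t₁ t₂ t₃ t₄ D → 0ℤ < D → EvenApproximation t₁ t₂ t₃ t₄ D
evenApproximation₄ t₁ t₂ t₃ t₄ D 0<D =
  fromRoundings (nearestMultiple t₁ D 0<D) (nearestMultiple t₂ D 0<D) (nearestMultiple t₃ D 0<D) (nearestMultiple t₄ D 0<D)
  where
  Rounding : ℤ → Set
  Rounding t = ∃ λ q → HalfBounded D (t - q *ℤ D)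
  fromRoundings : Rounding t₁ → Rounding t₂ → Rounding t₃ → Rounding t₄ → EvenApproximation t₁ t₂ t₃ t₄ D
  fromRoundings (q₁ , b₁) (q₂ , b₂) (q₃ , b₃) (q₄ , b₄) = [ fromEven , fromOdd ]′ (even-or-odd Q)
    where
    r₁ = t₁ - q₁ *ℤ D
    r₂ = t₂ - q₂ *ℤ D
    r₃ = t₃ - q₃ *ℤ D
    r₄ = t₄ - q₄ *ℤ D
    Q = sq q₁ +ℤ sq q₂ +ℤ sq q₃ +ℤ sq q₄
    S = sq r₁ +ℤ sq r₂ +ℤ sq r₃ +ℤ sq r₄
    fromEven : Even Q → EvenApproximation t₁ t₂ t₃ t₄ D
    fromEven even = evenApproximation q₁ q₂ q₃ q₄ even (ℤ.*-cancelˡ-≤-pos S (D *ℤ D) (+ 4) (begin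
      + 4 *ℤ S                                                ≡⟨ doubled r₁ r₂ r₃ r₄ ⟩
      sq (r₁ +ℤ r₁) +ℤ sq (r₂ +ℤ r₂) +ℤ sq (r₃ +ℤ r₃) +ℤ sq (r₄ +ℤ r₄) ≤⟨ ℤ.+-mono-≤ (ℤ.+-mono-≤ (ℤ.+-mono-≤
                                                                     (halfBounded⇒4r²≤D² b₁) (halfBounded⇒4r²≤D² b₂))
                                                                     (halfBounded⇒4r²≤D² b₃)) (halfBounded⇒4r²≤D² b₄) ⟩
      D *ℤ D +ℤ D *ℤ D +ℤ D *ℤ D +ℤ D *ℤ D                    ≡⟨ four-times (D *ℤ D) ⟩
      + 4 *ℤ (D *ℤ D)                                         ∎))
      where
      open ℤ.≤-Reasoning
      doubled : ∀ a b c d → + 4 *ℤ (a *ℤ a +ℤ b *ℤ b +ℤ c *ℤ c +ℤ d *ℤ d)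
                          ≡ (a +ℤ a) *ℤ (a +ℤ a) +ℤ (b +ℤ b) *ℤ (b +ℤ b) +ℤ (c +ℤ c) *ℤ (c +ℤ c) +ℤ (d +ℤ d) *ℤ (d +ℤ d)
      doubled = ℤ-Solver.solve-∀
      four-times : ∀ x → x +ℤ x +ℤ x +ℤ x ≡ + 4 *ℤ x
      four-times = ℤ-Solver.solve-∀
    fromOdd : Odd Q → EvenApproximation t₁ t₂ t₃ t₄ D
    fromOdd odd = largest (S ≤? + 4 *ℤ sq r₁) (S ≤? + 4 *ℤ sq r₂) (S ≤? + 4 *ℤ sq r₃) (S ≤? + 4 *ℤ sq r₄)
      where
      Flipped : ℤ → ℤ → ℤ → Set
      Flipped t O R = ∃ λ q′ → Even (sq q′ +ℤ R) × sq (t - q′ *ℤ D) +ℤ O ≤ D *ℤ D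
      at₁ : S ≤ + 4 *ℤ sq r₁ → EvenApproximation t₁ t₂ t₃ t₄ D
      at₁ big = place (flip-into t₁ q₁ D (sq r₂ +ℤ sq r₃ +ℤ sq r₄) (sq q₂ +ℤ sq q₃ +ℤ sq q₄) b₁
                     (subst (_≤ + 4 *ℤ sq r₁) (move₁ (sq r₁) (sq r₂) (sq r₃) (sq r₄)) big)
                     (subst Odd (move₁ (sq q₁) (sq q₂) (sq q₃) (sq q₄)) odd))
        where
        place : Flipped t₁ (sq r₂ +ℤ sq r₃ +ℤ sq r₄) (sq q₂ +ℤ sq q₃ +ℤ sq q₄) → EvenApproximation t₁ t₂ t₃ t₄ D
        place (q′ , even , close) = evenApproximation q′ q₂ q₃ q₄
          (subst Even (sym (move₁ (sq q′) (sq q₂) (sq q₃) (sq q₄))) even)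
          (subst (_≤ D *ℤ D) (sym (move₁ (sq (t₁ - q′ *ℤ D)) (sq r₂) (sq r₃) (sq r₄))) close)
      at₂ : S ≤ + 4 *ℤ sq r₂ → EvenApproximation t₁ t₂ t₃ t₄ D
      at₂ big = place (flip-into t₂ q₂ D (sq r₁ +ℤ sq r₃ +ℤ sq r₄) (sq q₁ +ℤ sq q₃ +ℤ sq q₄) b₂
                     (subst (_≤ + 4 *ℤ sq r₂) (move₂ (sq r₁) (sq r₂) (sq r₃) (sq r₄)) big)
                     (subst Odd (move₂ (sq q₁) (sq q₂) (sq q₃) (sq q₄)) odd))
        where
        place : Flipped t₂ (sq r₁ +ℤ sq r₃ +ℤ sq r₄) (sq q₁ +ℤ sq q₃ +ℤ sq q₄) → EvenApproximation t₁ t₂ t₃ t₄ D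
        place (q′ , even , close) = evenApproximation q₁ q′ q₃ q₄
          (subst Even (sym (move₂ (sq q₁) (sq q′) (sq q₃) (sq q₄))) even)
          (subst (_≤ D *ℤ D) (sym (move₂ (sq r₁) (sq (t₂ - q′ *ℤ D)) (sq r₃) (sq r₄))) close)
      at₃ : S ≤ + 4 *ℤ sq r₃ → EvenApproximation t₁ t₂ t₃ t₄ D
      at₃ big = place (flip-into t₃ q₃ D (sq r₁ +ℤ sq r₂ +ℤ sq r₄) (sq q₁ +ℤ sq q₂ +ℤ sq q₄) b₃
                     (subst (_≤ + 4 *ℤ sq r₃) (move₃ (sq r₁) (sq r₂) (sq r₃) (sq r₄)) big)
                     (subst Odd (move₃ (sq q₁) (sq q₂) (sq q₃) (sq q₄)) odd))
        where
        place : Flipped t₃ (sq r₁ +ℤ sq r₂ +ℤ sq r₄) (sq q₁ +ℤ sq q₂ +ℤ sq q₄) → EvenApproximation t₁ t₂ t₃ t₄ D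
        place (q′ , even , close) = evenApproximation q₁ q₂ q′ q₄
          (subst Even (sym (move₃ (sq q₁) (sq q₂) (sq q′) (sq q₄))) even)
          (subst (_≤ D *ℤ D) (sym (move₃ (sq r₁) (sq r₂) (sq (t₃ - q′ *ℤ D)) (sq r₄))) close)
      at₄ : S ≤ + 4 *ℤ sq r₄ → EvenApproximation t₁ t₂ t₃ t₄ D
      at₄ big = place (flip-into t₄ q₄ D (sq r₁ +ℤ sq r₂ +ℤ sq r₃) (sq q₁ +ℤ sq q₂ +ℤ sq q₃) b₄
                     (subst (_≤ + 4 *ℤ sq r₄) (move₄ (sq r₁) (sq r₂) (sq r₃) (sq r₄)) big)
                     (subst Odd (move₄ (sq q₁) (sq q₂) (sq q₃) (sq q₄)) odd))
        where
        place : Flipped t₄ (sq r₁ +ℤ sq r₂ +ℤ sq r₃) (sq q₁ +ℤ sq q₂ +ℤ sq q₃) → EvenApproximation t₁ t₂ t₃ t₄ D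
        place (q′ , even , close) = evenApproximation q₁ q₂ q₃ q′
          (subst Even (sym (move₄ (sq q₁) (sq q₂) (sq q₃) (sq q′))) even)
          (subst (_≤ D *ℤ D) (sym (move₄ (sq r₁) (sq r₂) (sq r₃) (sq (t₄ - q′ *ℤ D)))) close)
      largest : Dec (S ≤ + 4 *ℤ sq r₁) → Dec (S ≤ + 4 *ℤ sq r₂) → Dec (S ≤ + 4 *ℤ sq r₃) → Dec (S ≤ + 4 *ℤ sq r₄) →
                EvenApproximation t₁ t₂ t₃ t₄ D
      largest (yes big) _         _         _         = at₁ big
      largest (no _)    (yes big) _         _         = at₂ big
      largest (no _)    (no _)    (yes big) _         = at₃ big
      largest (no _)    (no _)    (no _)    (yes big) = at₄ big
      largest (no s₁)   (no s₂)   (no s₃)   (no s₄)   = ⊥-elim (ℤ.<-irrefl refl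
        (subst (_< S +ℤ S +ℤ S +ℤ S) (spread r₁ r₂ r₃ r₄)
          (ℤ.+-mono-< (ℤ.+-mono-< (ℤ.+-mono-< (ℤ.≰⇒> s₁) (ℤ.≰⇒> s₂)) (ℤ.≰⇒> s₃)) (ℤ.≰⇒> s₄))))
        where
        spread : ∀ a b c d → let s = a *ℤ a +ℤ b *ℤ b +ℤ c *ℤ c +ℤ d *ℤ d in
                 + 4 *ℤ (a *ℤ a) +ℤ + 4 *ℤ (b *ℤ b) +ℤ + 4 *ℤ (c *ℤ c) +ℤ + 4 *ℤ (d *ℤ d) ≡ s +ℤ s +ℤ s +ℤ s
        spread = ℤ-Solver.solve-∀

-- A Hermitian form of signature (3,1) and its Eichler transformations

record ℤ[i]⁴ : Set where
  constructor quad
  field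
    π₁ π₂ π₃ π₄ : ℤ[i]
open ℤ[i]⁴

infix 7 _⊙_
_⊙_ : ℤ[i]⁴ → ℤ[i]⁴ → ℤ[i]
quad x₁ x₂ x₃ x₄ ⊙ quad y₁ y₂ y₃ y₄ = conj x₁ *ᵍ y₁ +ᵍ conj x₂ *ᵍ y₂ +ᵍ conj x₃ *ᵍ y₃ -ᵍ conj x₄ *ᵍ y₄

record UnitOrthogonal (w : ℤ[i]⁴) : Set where
  field
    z          : ℤ[i]⁴
    orthogonal : w ⊙ z ≡ 0ᵍ
    unit       : z ⊙ z ≡ 1ᵍ

Isometry : (ℤ[i]⁴ → ℤ[i]⁴) → Set
Isometry Ψ = ∀ x y → Ψ x ⊙ Ψ y ≡ x ⊙ y

transport : ∀ {w w′} Ψ → Isometry Ψ → Ψ w′ ≡ w → UnitOrthogonal w′ → UnitOrthogonal w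
transport {w′ = w′} Ψ isometry refl u = record
  { z = Ψ z ; orthogonal = trans (isometry w′ z) orthogonal ; unit = trans (isometry z z) unit }
  where open UnitOrthogonal u

unitOrthogonal-π₁≡0 : ∀ w → π₁ w ≡ 0ᵍ → UnitOrthogonal w
unitOrthogonal-π₁≡0 (quad x₁ x₂ x₃ x₄) x₁≡0 = record
  { z = quad 1ᵍ 0ᵍ 0ᵍ 0ᵍ ; orthogonal = trans (pick (conj x₁) (conj x₂) (conj x₃) (conj x₄)) (cong conj x₁≡0) ; unit = refl }
  where
  pick : ∀ a b c d → a *ᵍ 1ᵍ +ᵍ b *ᵍ 0ᵍ +ᵍ c *ᵍ 0ᵍ -ᵍ d *ᵍ 0ᵍ ≡ a
  pick = solve-∀ ℤ[i]-ring

unitOrthogonal-π₃≡0 : ∀ w → π₃ w ≡ 0ᵍ → UnitOrthogonal w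
unitOrthogonal-π₃≡0 (quad x₁ x₂ x₃ x₄) x₃≡0 = record
  { z = quad 0ᵍ 0ᵍ 1ᵍ 0ᵍ ; orthogonal = trans (pick (conj x₁) (conj x₂) (conj x₃) (conj x₄)) (cong conj x₃≡0) ; unit = refl }
  where
  pick : ∀ a b c d → a *ᵍ 0ᵍ +ᵍ b *ᵍ 0ᵍ +ᵍ c *ᵍ 1ᵍ -ᵍ d *ᵍ 0ᵍ ≡ c
  pick = solve-∀ ℤ[i]-ring

Unit : ℤ[i] → Set
Unit u = conj u *ᵍ u ≡ 1ᵍ

scale₃ : ℤ[i] → ℤ[i]⁴ → ℤ[i]⁴
scale₃ u (quad x₁ x₂ x₃ x₄) = quad x₁ x₂ (u *ᵍ x₃) x₄

scale₃-isometry : ∀ u → Unit u → Isometry (scale₃ u)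
scale₃-isometry u ūu≡1 (quad x₁ x₂ x₃ x₄) (quad y₁ y₂ y₃ y₄) =
  cong (λ t → conj x₁ *ᵍ y₁ +ᵍ conj x₂ *ᵍ y₂ +ᵍ t -ᵍ conj x₄ *ᵍ y₄) (begin
    conj (u *ᵍ x₃) *ᵍ (u *ᵍ y₃)       ≡⟨ cong (_*ᵍ (u *ᵍ y₃)) (conj-*ᵍ u x₃) ⟩
    conj u *ᵍ conj x₃ *ᵍ (u *ᵍ y₃)    ≡⟨ regroup (conj u) (conj x₃) u y₃ ⟩
    conj u *ᵍ u *ᵍ (conj x₃ *ᵍ y₃)    ≡⟨ cong (_*ᵍ (conj x₃ *ᵍ y₃)) ūu≡1 ⟩
    1ᵍ *ᵍ (conj x₃ *ᵍ y₃)             ≡⟨ *ᵍ-identityˡ _ ⟩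
    conj x₃ *ᵍ y₃                     ∎)
  where
  open ≡-Reasoning
  regroup : ∀ ū x̄ u y → ū *ᵍ x̄ *ᵍ (u *ᵍ y) ≡ ū *ᵍ u *ᵍ (x̄ *ᵍ y)
  regroup = solve-∀ ℤ[i]-ring

scale₃-inverse : ∀ u → Unit u → ∀ x → scale₃ (conj u) (scale₃ u x) ≡ x
scale₃-inverse u ūu≡1 (quad x₁ x₂ x₃ x₄) =
  cong (λ t → quad x₁ x₂ t x₄) (trans (sym (*ᵍ-assoc (conj u) u x₃)) (trans (cong (_*ᵍ x₃) ūu≡1) (*ᵍ-identityˡ x₃)))

unitOrthogonal-scale₃ : ∀ u → Unit u → ∀ w → UnitOrthogonal (scale₃ u w) → UnitOrthogonal w
unitOrthogonal-scale₃ u ūu≡1 w = transport (scale₃ (conj u)) (scale₃-isometry (conj u) ūcu≡1) (scale₃-inverse u ūu≡1 w)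
  where
  ūcu≡1 : Unit (conj u)
  ūcu≡1 = trans (cong (_*ᵍ conj u) (conj-involutive u)) (trans (*ᵍ-comm u (conj u)) ūu≡1)

Admissible : ℤ[i] → ℤ[i] → ℤ[i] → Set
Admissible a₁ a₂ μ = μ +ᵍ conj μ +ᵍ a₁ *ᵍ conj a₁ +ᵍ a₂ *ᵍ conj a₂ ≡ 0ᵍ

-- x ↦ x + ⟨f, x⟩ a − ⟨a, x⟩ f + μ ⟨f, x⟩ f for the isotropic f = (0, 0, 1, 1) and a = (a₁, a₂, 0, 0)
eichler : ℤ[i] → ℤ[i] → ℤ[i] → ℤ[i]⁴ → ℤ[i]⁴
eichler a₁ a₂ μ (quad x₁ x₂ x₃ x₄) =
  quad (x₁ +ᵍ (x₃ -ᵍ x₄) *ᵍ a₁) (x₂ +ᵍ (x₃ -ᵍ x₄) *ᵍ a₂)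
       (x₃ -ᵍ (conj a₁ *ᵍ x₁ +ᵍ conj a₂ *ᵍ x₂) +ᵍ μ *ᵍ (x₃ -ᵍ x₄))
       (x₄ -ᵍ (conj a₁ *ᵍ x₁ +ᵍ conj a₂ *ᵍ x₂) +ᵍ μ *ᵍ (x₃ -ᵍ x₄))

private
  cong₄ : ∀ {A B C D E : Set} (f : A → B → C → D → E) {a a′ b b′ c c′ d d′} →
          a ≡ a′ → b ≡ b′ → c ≡ c′ → d ≡ d′ → f a b c d ≡ f a′ b′ c′ d′
  cong₄ f refl refl refl refl = refl

  conj-shift : ∀ x₁ x₃ x₄ a → conj (x₁ +ᵍ (x₃ -ᵍ x₄) *ᵍ a) ≡ conj x₁ +ᵍ (conj x₃ -ᵍ conj x₄) *ᵍ conj a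
  conj-shift x₁ x₃ x₄ a =
    trans (conj-+ᵍ x₁ ((x₃ -ᵍ x₄) *ᵍ a)) (cong (conj x₁ +ᵍ_) (trans (conj-*ᵍ (x₃ -ᵍ x₄) a) (cong (_*ᵍ conj a) (conj--ᵍ x₃ x₄))))

  conj-tilt : ∀ y x₁ x₂ x₃ x₄ a₁ a₂ μ →
              conj (y -ᵍ (conj a₁ *ᵍ x₁ +ᵍ conj a₂ *ᵍ x₂) +ᵍ μ *ᵍ (x₃ -ᵍ x₄))
              ≡ conj y -ᵍ (a₁ *ᵍ conj x₁ +ᵍ a₂ *ᵍ conj x₂) +ᵍ conj μ *ᵍ (conj x₃ -ᵍ conj x₄)
  conj-tilt y x₁ x₂ x₃ x₄ a₁ a₂ μ = trans (conj-+ᵍ (y -ᵍ s) (μ *ᵍ (x₃ -ᵍ x₄))) (cong₂ _+ᵍ_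
    (trans (conj--ᵍ y s) (cong (λ t → conj y -ᵍ t)
      (trans (conj-+ᵍ (conj a₁ *ᵍ x₁) (conj a₂ *ᵍ x₂)) (cong₂ _+ᵍ_ (conj-conj-*ᵍ a₁ x₁) (conj-conj-*ᵍ a₂ x₂)))))
    (trans (conj-*ᵍ μ (x₃ -ᵍ x₄)) (cong (conj μ *ᵍ_) (conj--ᵍ x₃ x₄))))
    where
    conj-conj-*ᵍ : ∀ a x → conj (conj a *ᵍ x) ≡ a *ᵍ conj x
    conj-conj-*ᵍ a x = trans (conj-*ᵍ (conj a) x) (cong (_*ᵍ conj x) (conj-involutive a))
    s = conj a₁ *ᵍ x₁ +ᵍ conj a₂ *ᵍ x₂

  shear-expansion : ∀ X₁ X₂ X₃ X₄ y₁ y₂ y₃ y₄ a₁ a₂ A₁ A₂ μ M →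
    (X₁ +ᵍ (X₃ -ᵍ X₄) *ᵍ A₁) *ᵍ (y₁ +ᵍ (y₃ -ᵍ y₄) *ᵍ a₁) +ᵍ (X₂ +ᵍ (X₃ -ᵍ X₄) *ᵍ A₂) *ᵍ (y₂ +ᵍ (y₃ -ᵍ y₄) *ᵍ a₂)
    +ᵍ (X₃ -ᵍ (a₁ *ᵍ X₁ +ᵍ a₂ *ᵍ X₂) +ᵍ M *ᵍ (X₃ -ᵍ X₄)) *ᵍ (y₃ -ᵍ (A₁ *ᵍ y₁ +ᵍ A₂ *ᵍ y₂) +ᵍ μ *ᵍ (y₃ -ᵍ y₄))
    -ᵍ (X₄ -ᵍ (a₁ *ᵍ X₁ +ᵍ a₂ *ᵍ X₂) +ᵍ M *ᵍ (X₃ -ᵍ X₄)) *ᵍ (y₄ -ᵍ (A₁ *ᵍ y₁ +ᵍ A₂ *ᵍ y₂) +ᵍ μ *ᵍ (y₃ -ᵍ y₄))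
    ≡ X₁ *ᵍ y₁ +ᵍ X₂ *ᵍ y₂ +ᵍ X₃ *ᵍ y₃ -ᵍ X₄ *ᵍ y₄ +ᵍ (X₃ -ᵍ X₄) *ᵍ (y₃ -ᵍ y₄) *ᵍ (μ +ᵍ M +ᵍ a₁ *ᵍ A₁ +ᵍ a₂ *ᵍ A₂)
  shear-expansion = solve-∀ ℤ[i]-ring

eichler-isometry : ∀ a₁ a₂ μ → Admissible a₁ a₂ μ → Isometry (eichler a₁ a₂ μ)
eichler-isometry a₁ a₂ μ admissible x@(quad x₁ x₂ x₃ x₄) y@(quad y₁ y₂ y₃ y₄) = begin
  eichler a₁ a₂ μ x ⊙ eichler a₁ a₂ μ y
    ≡⟨ cong₄ (λ p₁ p₂ p₃ p₄ → p₁ *ᵍ y₁′ +ᵍ p₂ *ᵍ y₂′ +ᵍ p₃ *ᵍ y₃′ -ᵍ p₄ *ᵍ y₄′)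
             (conj-shift x₁ x₃ x₄ a₁) (conj-shift x₂ x₃ x₄ a₂)
             (conj-tilt x₃ x₁ x₂ x₃ x₄ a₁ a₂ μ) (conj-tilt x₄ x₁ x₂ x₃ x₄ a₁ a₂ μ) ⟩
  _ ≡⟨ shear-expansion (conj x₁) (conj x₂) (conj x₃) (conj x₄) y₁ y₂ y₃ y₄ a₁ a₂ (conj a₁) (conj a₂) μ (conj μ) ⟩
  x ⊙ y +ᵍ (conj x₃ -ᵍ conj x₄) *ᵍ (y₃ -ᵍ y₄) *ᵍ (μ +ᵍ conj μ +ᵍ a₁ *ᵍ conj a₁ +ᵍ a₂ *ᵍ conj a₂)
    ≡⟨ cong (λ t → x ⊙ y +ᵍ (conj x₃ -ᵍ conj x₄) *ᵍ (y₃ -ᵍ y₄) *ᵍ t) admissible ⟩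
  x ⊙ y +ᵍ (conj x₃ -ᵍ conj x₄) *ᵍ (y₃ -ᵍ y₄) *ᵍ 0ᵍ
    ≡⟨ drop-zero (x ⊙ y) ((conj x₃ -ᵍ conj x₄) *ᵍ (y₃ -ᵍ y₄)) ⟩
  x ⊙ y ∎
  where
  open ≡-Reasoning
  y₁′ = y₁ +ᵍ (y₃ -ᵍ y₄) *ᵍ a₁
  y₂′ = y₂ +ᵍ (y₃ -ᵍ y₄) *ᵍ a₂
  y₃′ = y₃ -ᵍ (conj a₁ *ᵍ y₁ +ᵍ conj a₂ *ᵍ y₂) +ᵍ μ *ᵍ (y₃ -ᵍ y₄)
  y₄′ = y₄ -ᵍ (conj a₁ *ᵍ y₁ +ᵍ conj a₂ *ᵍ y₂) +ᵍ μ *ᵍ (y₃ -ᵍ y₄)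
  drop-zero : ∀ h k → h +ᵍ k *ᵍ 0ᵍ ≡ h
  drop-zero = solve-∀ ℤ[i]-ring

admissible-inverse : ∀ a₁ a₂ μ → Admissible a₁ a₂ μ → Admissible (-ᵍ a₁) (-ᵍ a₂) (conj μ)
admissible-inverse a₁ a₂ μ admissible =
  trans (cong (λ t → conj μ +ᵍ t +ᵍ (-ᵍ a₁) *ᵍ (-ᵍ conj a₁) +ᵍ (-ᵍ a₂) *ᵍ (-ᵍ conj a₂)) (conj-involutive μ))
        (trans (reorder μ (conj μ) a₁ (conj a₁) a₂ (conj a₂)) admissible)
  where
  reorder : ∀ μ μ̄ a₁ ā₁ a₂ ā₂ → μ̄ +ᵍ μ +ᵍ (-ᵍ a₁) *ᵍ (-ᵍ ā₁) +ᵍ (-ᵍ a₂) *ᵍ (-ᵍ ā₂) ≡ μ +ᵍ μ̄ +ᵍ a₁ *ᵍ ā₁ +ᵍ a₂ *ᵍ ā₂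
  reorder = solve-∀ ℤ[i]-ring

eichler-inverse : ∀ a₁ a₂ μ → Admissible a₁ a₂ μ → ∀ x → eichler (-ᵍ a₁) (-ᵍ a₂) (conj μ) (eichler a₁ a₂ μ x) ≡ x
eichler-inverse a₁ a₂ μ admissible (quad x₁ x₂ x₃ x₄) = cong₄ quad
  (undo-shift x₁ x₃ x₄ a₁ (conj a₁ *ᵍ x₁ +ᵍ conj a₂ *ᵍ x₂) μ)
  (undo-shift x₂ x₃ x₄ a₂ (conj a₁ *ᵍ x₁ +ᵍ conj a₂ *ᵍ x₂) μ)
  (trans (undo-tilt x₃ x₁ x₂ x₃ x₄ a₁ a₂ (conj a₁) (conj a₂) μ (conj μ)) (vanishes x₃))
  (trans (undo-tilt x₄ x₁ x₂ x₃ x₄ a₁ a₂ (conj a₁) (conj a₂) μ (conj μ)) (vanishes x₄))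
  where
  shift = x₃ -ᵍ x₄
  undo-shift : ∀ x x₃ x₄ a s μ →
    (x +ᵍ (x₃ -ᵍ x₄) *ᵍ a) +ᵍ ((x₃ -ᵍ s +ᵍ μ *ᵍ (x₃ -ᵍ x₄)) -ᵍ (x₄ -ᵍ s +ᵍ μ *ᵍ (x₃ -ᵍ x₄))) *ᵍ (-ᵍ a) ≡ x
  undo-shift = solve-∀ ℤ[i]-ring
  undo-tilt : ∀ y x₁ x₂ x₃ x₄ a₁ a₂ ā₁ ā₂ μ μ̄ →
    (y -ᵍ (ā₁ *ᵍ x₁ +ᵍ ā₂ *ᵍ x₂) +ᵍ μ *ᵍ (x₃ -ᵍ x₄))
      -ᵍ ((-ᵍ ā₁) *ᵍ (x₁ +ᵍ (x₃ -ᵍ x₄) *ᵍ a₁) +ᵍ (-ᵍ ā₂) *ᵍ (x₂ +ᵍ (x₃ -ᵍ x₄) *ᵍ a₂))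
      +ᵍ μ̄ *ᵍ ((x₃ -ᵍ (ā₁ *ᵍ x₁ +ᵍ ā₂ *ᵍ x₂) +ᵍ μ *ᵍ (x₃ -ᵍ x₄)) -ᵍ (x₄ -ᵍ (ā₁ *ᵍ x₁ +ᵍ ā₂ *ᵍ x₂) +ᵍ μ *ᵍ (x₃ -ᵍ x₄)))
    ≡ y +ᵍ (x₃ -ᵍ x₄) *ᵍ (μ +ᵍ μ̄ +ᵍ a₁ *ᵍ ā₁ +ᵍ a₂ *ᵍ ā₂)
  undo-tilt = solve-∀ ℤ[i]-ring
  vanishes : ∀ y → y +ᵍ shift *ᵍ (μ +ᵍ conj μ +ᵍ a₁ *ᵍ conj a₁ +ᵍ a₂ *ᵍ conj a₂) ≡ y
  vanishes y = trans (cong (λ t → y +ᵍ shift *ᵍ t) admissible) (trans (cong (y +ᵍ_) (*ᵍ-zeroʳ shift)) (+ᵍ-identityʳ y))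

eichler-δ : ∀ a₁ a₂ μ x → π₄ (eichler a₁ a₂ μ x) -ᵍ π₃ (eichler a₁ a₂ μ x) ≡ π₄ x -ᵍ π₃ x
eichler-δ a₁ a₂ μ (quad x₁ x₂ x₃ x₄) = cancel x₃ x₄ (conj a₁ *ᵍ x₁ +ᵍ conj a₂ *ᵍ x₂) (μ *ᵍ (x₃ -ᵍ x₄))
  where
  cancel : ∀ x₃ x₄ s e → (x₄ -ᵍ s +ᵍ e) -ᵍ (x₃ -ᵍ s +ᵍ e) ≡ x₄ -ᵍ x₃
  cancel = solve-∀ ℤ[i]-ring

unitOrthogonal-eichler : ∀ a₁ a₂ μ → Admissible a₁ a₂ μ → ∀ w → UnitOrthogonal (eichler a₁ a₂ μ w) → UnitOrthogonal w
unitOrthogonal-eichler a₁ a₂ μ admissible w =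
  transport (eichler (-ᵍ a₁) (-ᵍ a₂) (conj μ)) (eichler-isometry (-ᵍ a₁) (-ᵍ a₂) (conj μ) (admissible-inverse a₁ a₂ μ admissible))
            (eichler-inverse a₁ a₂ μ admissible w)

-- Descent

Isotropic : ℤ[i]⁴ → Set
Isotropic w = w ⊙ w ≡ 0ᵍ

isotropic-norms : ∀ x₁ x₂ x₃ x₄ → Isotropic (quad x₁ x₂ x₃ x₄) → norm x₁ +ℤ norm x₂ ≡ norm x₄ - norm x₃
isotropic-norms x₁ x₂ x₃ x₄ iso = rearrange (norm x₁) (norm x₂) (norm x₃) (norm x₄) (cong proj₁ (begin
  ι (norm x₁ +ℤ norm x₂ +ℤ norm x₃ - norm x₄)
    ≡⟨ cong₂ (λ p q → p +ᵍ q +ᵍ ι (norm x₃) -ᵍ ι (norm x₄)) (*ᵍ-conjˡ x₁) (*ᵍ-conjˡ x₂) ⟨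
  conj x₁ *ᵍ x₁ +ᵍ conj x₂ *ᵍ x₂ +ᵍ ι (norm x₃) -ᵍ ι (norm x₄)
    ≡⟨ cong₂ (λ p q → conj x₁ *ᵍ x₁ +ᵍ conj x₂ *ᵍ x₂ +ᵍ p -ᵍ q) (*ᵍ-conjˡ x₃) (*ᵍ-conjˡ x₄) ⟨
  quad x₁ x₂ x₃ x₄ ⊙ quad x₁ x₂ x₃ x₄                   ≡⟨ iso ⟩
  0ᵍ                                                   ∎))
  where
  open ≡-Reasoning
  rearrange : ∀ a b c d → a +ℤ b +ℤ c - d ≡ 0ℤ → a +ℤ b ≡ d - c
  rearrange a b c d e = trans (shuffle a b c d) (trans (cong (_+ℤ (d - c)) e) (ℤ.+-identityˡ (d - c)))
    where
    shuffle : ∀ a b c d → a +ℤ b ≡ (a +ℤ b +ℤ c - d) +ℤ (d - c)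
    shuffle = ℤ-Solver.solve-∀

Δ : ℤ[i]⁴ → ℤ[i]
Δ w = π₄ w -ᵍ π₃ w

Δ≢0ᵍ : ∀ w → Isotropic w → π₁ w ≢ 0ᵍ → Δ w ≢ 0ᵍ
Δ≢0ᵍ (quad x₁ x₂ x₃ x₄) iso x₁≢0 Δ≡0 = x₁≢0 (norm≡0⇒≡0ᵍ x₁ (nonNeg-sum≡0ˡ (0≤norm x₁) (0≤norm x₂)
  (trans (isotropic-norms x₁ x₂ x₃ x₄ iso) (trans (cong (λ t → norm t - norm x₃) (x-ᵍy≡0ᵍ⇒x≡y x₄ x₃ Δ≡0)) (ℤ.+-inverseʳ (norm x₃))))))

measure : ℤ[i]⁴ → ℕ
measure w = ∣ norm (Δ w) ∣

re-sum*conj-diff : ∀ x₄ x₃ → re ((x₄ +ᵍ x₃) *ᵍ conj (x₄ -ᵍ x₃)) ≡ norm x₄ - norm x₃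
re-sum*conj-diff (a , b) (c , d) = identity a b c d
  where
  identity : ∀ a b c d → (a +ℤ c) *ℤ (a - c) - (b +ℤ d) *ℤ (- (b - d)) ≡ (a *ℤ a +ℤ b *ℤ b) - (c *ℤ c +ℤ d *ℤ d)
  identity = ℤ-Solver.solve-∀

rotate-pair : ∀ u₁ u₂ X Y D →
  (1ᵍ -ᵍ (u₁ , u₂)) *ᵍ (X , Y) +ᵍ (1ᵍ +ᵍ (u₁ , u₂)) *ᵍ ι D
  ≡ ((+ 1 - u₁) *ℤ X +ℤ u₂ *ℤ Y +ℤ (+ 1 +ℤ u₁) *ℤ D , (+ 1 - u₁) *ℤ Y - u₂ *ℤ X +ℤ u₂ *ℤ D)
rotate-pair u₁ u₂ X Y D = cong₂ _,_ (re-eq u₁ u₂ X Y D) (im-eq u₁ u₂ X Y D)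
  where
  re-eq : ∀ u₁ u₂ X Y D → (+ 1 - u₁) *ℤ X - (+ 0 - u₂) *ℤ Y +ℤ ((+ 1 +ℤ u₁) *ℤ D - (+ 0 +ℤ u₂) *ℤ + 0)
                        ≡ (+ 1 - u₁) *ℤ X +ℤ u₂ *ℤ Y +ℤ (+ 1 +ℤ u₁) *ℤ D
  re-eq = ℤ-Solver.solve-∀
  im-eq : ∀ u₁ u₂ X Y D → (+ 1 - u₁) *ℤ Y +ℤ (+ 0 - u₂) *ℤ X +ℤ ((+ 1 +ℤ u₁) *ℤ + 0 +ℤ (+ 0 +ℤ u₂) *ℤ D)
                        ≡ (+ 1 - u₁) *ℤ Y - u₂ *ℤ X +ℤ u₂ *ℤ D
  im-eq = ℤ-Solver.solve-∀

unitChoice : ∀ {X Y D} → 0ℤ ≤ X → X ≤ D → - D ≤ Y → Y ≤ D →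
             (X ≡ D × Y ≡ 0ℤ) ⊎ ∃ λ u → Unit u × norm ((1ᵍ -ᵍ u) *ᵍ (X , Y) +ᵍ (1ᵍ +ᵍ u) *ᵍ ι D) < + 4 *ℤ (D *ℤ D)
unitChoice {X} {Y} {D} 0≤X X≤D -D≤Y Y≤D = byCases (ℤ.<-cmp Y 0ℤ)
  where
  byCases : Tri (Y < 0ℤ) (Y ≡ 0ℤ) (Y > 0ℤ) →
            (X ≡ D × Y ≡ 0ℤ) ⊎ ∃ λ u → Unit u × norm ((1ᵍ -ᵍ u) *ᵍ (X , Y) +ᵍ (1ᵍ +ᵍ u) *ᵍ ι D) < + 4 *ℤ (D *ℤ D)
  byCases (tri< Y<0 _ _) = inj₂ (iᵍ , refl ,
    subst (_< + 4 *ℤ (D *ℤ D)) (sym (trans (cong norm (rotate-pair (+ 0) (+ 1) X Y D)) (by-i X Y D)))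
      (two-squares< 0≤X X≤D 0≤Y+D Y+D<D))
    where
    by-i : ∀ X Y D → let a = (+ 1 - + 0) *ℤ X +ℤ + 1 *ℤ Y +ℤ (+ 1 +ℤ + 0) *ℤ D
                         b = (+ 1 - + 0) *ℤ Y - + 1 *ℤ X +ℤ + 1 *ℤ D
                     in a *ℤ a +ℤ b *ℤ b ≡ + 2 *ℤ (X *ℤ X +ℤ (Y +ℤ D) *ℤ (Y +ℤ D))
    by-i = ℤ-Solver.solve-∀
    0≤Y+D : 0ℤ ≤ Y +ℤ D
    0≤Y+D = subst (0ℤ ≤_) (cong (Y +ℤ_) (ℤ.neg-involutive D)) (ℤ.i≤j⇒0≤j-i -D≤Y)
    Y+D<D : Y +ℤ D < D
    Y+D<D = subst (Y +ℤ D <_) (ℤ.+-identityˡ D) (ℤ.+-monoˡ-< D Y<0)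
  byCases (tri> _ _ 0<Y) = inj₂ (-ᵍ iᵍ , refl ,
    subst (_< + 4 *ℤ (D *ℤ D)) (sym (trans (cong norm (rotate-pair (+ 0) (- + 1) X Y D)) (by-conj-i X Y D)))
      (two-squares< 0≤X X≤D (ℤ.i≤j⇒0≤j-i Y≤D) D-Y<D))
    where
    by-conj-i : ∀ X Y D → let a = (+ 1 - + 0) *ℤ X +ℤ (- + 1) *ℤ Y +ℤ (+ 1 +ℤ + 0) *ℤ D
                              b = (+ 1 - + 0) *ℤ Y - (- + 1) *ℤ X +ℤ (- + 1) *ℤ D
                          in a *ℤ a +ℤ b *ℤ b ≡ + 2 *ℤ (X *ℤ X +ℤ (D - Y) *ℤ (D - Y))
    by-conj-i = ℤ-Solver.solve-∀
    D-Y<D : D - Y < D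
    D-Y<D = subst (D - Y <_) (ℤ.+-identityʳ D) (ℤ.+-monoʳ-< D (ℤ.neg-mono-< 0<Y))
  byCases (tri≈ _ Y≡0 _) = onBoundary (X ℤ.≟ D)
    where
    by-minus-one : ∀ X Y D → let a = (+ 1 - - + 1) *ℤ X +ℤ (- + 0) *ℤ Y +ℤ (+ 1 +ℤ - + 1) *ℤ D
                                 b = (+ 1 - - + 1) *ℤ Y - (- + 0) *ℤ X +ℤ (- + 0) *ℤ D
                             in a *ℤ a +ℤ b *ℤ b ≡ + 2 *ℤ (X *ℤ X +ℤ X *ℤ X) +ℤ + 4 *ℤ (Y *ℤ Y)
    by-minus-one = ℤ-Solver.solve-∀
    onBoundary : Dec (X ≡ D) →
                 (X ≡ D × Y ≡ 0ℤ) ⊎ ∃ λ u → Unit u × norm ((1ᵍ -ᵍ u) *ᵍ (X , Y) +ᵍ (1ᵍ +ᵍ u) *ᵍ ι D) < + 4 *ℤ (D *ℤ D)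
    onBoundary (yes X≡D) = inj₁ (X≡D , Y≡0)
    onBoundary (no X≢D)  = inj₂ (-ᵍ 1ᵍ , refl ,
      subst (_< + 4 *ℤ (D *ℤ D))
        (sym (trans (cong norm (rotate-pair (- + 1) (- + 0) X Y D))
             (trans (by-minus-one X Y D) (trans (cong (λ y → + 2 *ℤ (X *ℤ X +ℤ X *ℤ X) +ℤ + 4 *ℤ (y *ℤ y)) Y≡0)
                                                (ℤ.+-identityʳ (+ 2 *ℤ (X *ℤ X +ℤ X *ℤ X)))))))
        (two-squares< 0≤X X≤D 0≤X (ℤ.≤∧≢⇒< X≤D X≢D)))

-- 2 (x₄ - u x₃) δ̄ = (1 - u) (x₄ + x₃) δ̄ + (1 + u) δ δ̄, where δ = x₄ - x₃.
four-norm-rotated : ∀ x₃ x₄ u → let δ = x₄ -ᵍ x₃ in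
  + 4 *ℤ (norm (x₄ -ᵍ u *ᵍ x₃) *ℤ norm δ) ≡ norm ((1ᵍ -ᵍ u) *ᵍ ((x₄ +ᵍ x₃) *ᵍ conj δ) +ᵍ (1ᵍ +ᵍ u) *ᵍ ι (norm δ))
four-norm-rotated x₃ x₄ u = begin
  + 4 *ℤ (n *ℤ norm δ)                            ≡⟨ cong (λ t → + 4 *ℤ (n *ℤ t)) (norm-conj δ) ⟨
  + 4 *ℤ (n *ℤ norm (conj δ))                     ≡⟨ cong (+ 4 *ℤ_) (norm-*ᵍ z (conj δ)) ⟨
  norm (1ᵍ +ᵍ 1ᵍ) *ℤ norm (z *ᵍ conj δ)           ≡⟨ norm-*ᵍ (1ᵍ +ᵍ 1ᵍ) (z *ᵍ conj δ) ⟨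
  norm ((1ᵍ +ᵍ 1ᵍ) *ᵍ (z *ᵍ conj δ))              ≡⟨ cong norm (twice-rotated x₃ x₄ u (conj δ)) ⟩
  norm ((1ᵍ -ᵍ u) *ᵍ P +ᵍ (1ᵍ +ᵍ u) *ᵍ (δ *ᵍ conj δ)) ≡⟨ cong (λ t → norm ((1ᵍ -ᵍ u) *ᵍ P +ᵍ (1ᵍ +ᵍ u) *ᵍ t)) (*ᵍ-conjʳ δ) ⟩
  norm ((1ᵍ -ᵍ u) *ᵍ P +ᵍ (1ᵍ +ᵍ u) *ᵍ ι (norm δ)) ∎
  where
  open ≡-Reasoning
  δ = x₄ -ᵍ x₃
  z = x₄ -ᵍ u *ᵍ x₃
  n = norm z
  P = (x₄ +ᵍ x₃) *ᵍ conj δ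
  twice-rotated : ∀ x₃ x₄ u c → (1ᵍ +ᵍ 1ᵍ) *ᵍ ((x₄ -ᵍ u *ᵍ x₃) *ᵍ c) ≡ (1ᵍ -ᵍ u) *ᵍ ((x₄ +ᵍ x₃) *ᵍ c) +ᵍ (1ᵍ +ᵍ u) *ᵍ ((x₄ -ᵍ x₃) *ᵍ c)
  twice-rotated = solve-∀ ℤ[i]-ring

sum-conj-diff≡norm⇒≡0ᵍ : ∀ x₃ x₄ → x₄ -ᵍ x₃ ≢ 0ᵍ → (x₄ +ᵍ x₃) *ᵍ conj (x₄ -ᵍ x₃) ≡ ι (norm (x₄ -ᵍ x₃)) → x₃ ≡ 0ᵍ
sum-conj-diff≡norm⇒≡0ᵍ x₃ x₄ δ≢0 P≡D = *ᵍ-cancelˡ-≡ (1ᵍ +ᵍ 1ᵍ) x₃ 0ᵍ (λ ()) (begin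
  (1ᵍ +ᵍ 1ᵍ) *ᵍ x₃              ≡⟨ difference x₃ x₄ ⟩
  (x₄ +ᵍ x₃) -ᵍ (x₄ -ᵍ x₃)      ≡⟨ cong (_-ᵍ (x₄ -ᵍ x₃)) sum≡diff ⟩
  (x₄ -ᵍ x₃) -ᵍ (x₄ -ᵍ x₃)      ≡⟨ self-difference (x₄ -ᵍ x₃) ⟩
  (1ᵍ +ᵍ 1ᵍ) *ᵍ 0ᵍ              ∎)
  where
  open ≡-Reasoning
  δ = x₄ -ᵍ x₃
  difference : ∀ x₃ x₄ → (1ᵍ +ᵍ 1ᵍ) *ᵍ x₃ ≡ (x₄ +ᵍ x₃) -ᵍ (x₄ -ᵍ x₃)
  difference = solve-∀ ℤ[i]-ring
  self-difference : ∀ z → z -ᵍ z ≡ (1ᵍ +ᵍ 1ᵍ) *ᵍ 0ᵍ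
  self-difference = solve-∀ ℤ[i]-ring
  sum≡diff : x₄ +ᵍ x₃ ≡ δ
  sum≡diff = *ᵍ-cancelˡ-≡ (conj δ) (x₄ +ᵍ x₃) δ (conj-≢0ᵍ δ≢0) (begin
    conj δ *ᵍ (x₄ +ᵍ x₃)        ≡⟨ *ᵍ-comm (conj δ) (x₄ +ᵍ x₃) ⟩
    (x₄ +ᵍ x₃) *ᵍ conj δ        ≡⟨ P≡D ⟩
    ι (norm δ)                  ≡⟨ *ᵍ-conjˡ δ ⟨
    conj δ *ᵍ δ                 ∎)

shrink : ∀ x₁ x₂ x₃ x₄ → Isotropic (quad x₁ x₂ x₃ x₄) → let δ = x₄ -ᵍ x₃ ; Y = im ((x₄ +ᵍ x₃) *ᵍ conj δ) in
         δ ≢ 0ᵍ → norm x₁ +ℤ norm x₂ ≤ norm δ → - norm δ ≤ Y → Y ≤ norm δ →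
         x₃ ≡ 0ᵍ ⊎ ∃ λ u → Unit u × norm (x₄ -ᵍ u *ᵍ x₃) < norm δ
shrink x₁ x₂ x₃ x₄ iso δ≢0 small lower upper =
  Sum.map (λ (X≡D , Y≡0) → sum-conj-diff≡norm⇒≡0ᵍ x₃ x₄ δ≢0 (cong₂ _,_ X≡D Y≡0))
          (λ (u , unit , bound) → u , unit , ℤ.*-cancelʳ-<-nonNeg D {{ℤ.nonNegative (0≤norm δ)}}
             (ℤ.*-cancelˡ-<-nonNeg (+ 4) (subst (_< + 4 *ℤ (D *ℤ D)) (sym (four-norm-rotated x₃ x₄ u)) bound)))
          (unitChoice 0≤X X≤D lower upper)
  where
  δ = x₄ -ᵍ x₃
  D = norm δ
  X≡ : re ((x₄ +ᵍ x₃) *ᵍ conj δ) ≡ norm x₁ +ℤ norm x₂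
  X≡ = trans (re-sum*conj-diff x₄ x₃) (sym (isotropic-norms x₁ x₂ x₃ x₄ iso))
  0≤X : 0ℤ ≤ re ((x₄ +ᵍ x₃) *ᵍ conj δ)
  0≤X = subst (0ℤ ≤_) (sym X≡) (ℤ.+-mono-≤ (0≤norm x₁) (0≤norm x₂))
  X≤D : re ((x₄ +ᵍ x₃) *ᵍ conj δ) ≤ D
  X≤D = subst (_≤ D) (sym X≡) small

record Reduction (w : ℤ[i]⁴) : Set where
  constructor reduction
  field
    a₁ a₂ μ    : ℤ[i]
    admissible : Admissible a₁ a₂ μ
    first-two  : let w′ = eichler a₁ a₂ μ w in norm (π₁ w′) +ℤ norm (π₂ w′) ≤ norm (Δ w′)
    im-lower   : let w′ = eichler a₁ a₂ μ w in - norm (Δ w′) ≤ im ((π₄ w′ +ᵍ π₃ w′) *ᵍ conj (Δ w′))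
    im-upper   : let w′ = eichler a₁ a₂ μ w in im ((π₄ w′ +ᵍ π₃ w′) *ᵍ conj (Δ w′)) ≤ norm (Δ w′)

admissible-even : ∀ q₁ q₂ q₃ q₄ h τ → sq q₁ +ℤ sq q₂ +ℤ sq q₃ +ℤ sq q₄ ≡ h +ℤ h → Admissible (q₁ , q₂) (q₃ , q₄) (- h , τ)
admissible-even q₁ q₂ q₃ q₄ h τ even =
  trans (cong₂ (λ p q → μ +ᵍ conj μ +ᵍ p +ᵍ q) (*ᵍ-conjʳ (q₁ , q₂)) (*ᵍ-conjʳ (q₃ , q₄))) (cong₂ _,_ re≡0 (im≡0 τ))
  where
  μ : ℤ[i]
  μ = (- h , τ)
  regroup : ∀ h a b c d → - h +ℤ - h +ℤ (a *ℤ a +ℤ b *ℤ b) +ℤ (c *ℤ c +ℤ d *ℤ d) ≡ (a *ℤ a +ℤ b *ℤ b +ℤ c *ℤ c +ℤ d *ℤ d) - (h +ℤ h)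
  regroup = ℤ-Solver.solve-∀
  re≡0 : - h +ℤ - h +ℤ norm (q₁ , q₂) +ℤ norm (q₃ , q₄) ≡ 0ℤ
  re≡0 = trans (regroup h q₁ q₂ q₃ q₄) (trans (cong (_- (h +ℤ h)) even) (ℤ.+-inverseʳ (h +ℤ h)))
  im≡0 : ∀ τ → τ +ℤ - τ +ℤ + 0 +ℤ + 0 ≡ + 0
  im≡0 = ℤ-Solver.solve-∀

shifted-norm : ∀ x x₃ x₄ a → let δ = x₄ -ᵍ x₃ ; D = norm δ in
               norm (x +ᵍ (x₃ -ᵍ x₄) *ᵍ a) *ℤ D ≡ norm (x *ᵍ conj δ -ᵍ (re a *ℤ D , im a *ℤ D))
shifted-norm x x₃ x₄ a = trans (norm-*ᵍ-conj (x +ᵍ (x₃ -ᵍ x₄) *ᵍ a) δ) (cong norm (begin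
  (x +ᵍ (x₃ -ᵍ x₄) *ᵍ a) *ᵍ conj δ  ≡⟨ shift-conj x x₃ x₄ a (conj δ) ⟩
  x *ᵍ conj δ -ᵍ a *ᵍ (δ *ᵍ conj δ) ≡⟨ cong (λ t → x *ᵍ conj δ -ᵍ a *ᵍ t) (*ᵍ-conjʳ δ) ⟩
  x *ᵍ conj δ -ᵍ a *ᵍ ι (norm δ)   ≡⟨ cong (λ t → x *ᵍ conj δ -ᵍ t) (*ᵍ-ι a (norm δ)) ⟩
  x *ᵍ conj δ -ᵍ (re a *ℤ norm δ , im a *ℤ norm δ) ∎))
  where
  open ≡-Reasoning
  δ = x₄ -ᵍ x₃
  shift-conj : ∀ x x₃ x₄ a c → (x +ᵍ (x₃ -ᵍ x₄) *ᵍ a) *ᵍ c ≡ x *ᵍ c -ᵍ a *ᵍ ((x₄ -ᵍ x₃) *ᵍ c)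
  shift-conj = solve-∀ ℤ[i]-ring

shifted-pair≤ : ∀ x₁ x₂ x₃ x₄ q₁ q₂ q₃ q₄ → let δ = x₄ -ᵍ x₃ ; D = norm δ ; T₁ = x₁ *ᵍ conj δ ; T₂ = x₂ *ᵍ conj δ in
  0ℤ < D → sq (re T₁ - q₁ *ℤ D) +ℤ sq (im T₁ - q₂ *ℤ D) +ℤ sq (re T₂ - q₃ *ℤ D) +ℤ sq (im T₂ - q₄ *ℤ D) ≤ D *ℤ D →
  norm (x₁ +ᵍ (x₃ -ᵍ x₄) *ᵍ (q₁ , q₂)) +ℤ norm (x₂ +ᵍ (x₃ -ᵍ x₄) *ᵍ (q₃ , q₄)) ≤ D
shifted-pair≤ x₁ x₂ x₃ x₄ q₁ q₂ q₃ q₄ 0<D close = ℤ.*-cancelʳ-≤-pos (n₁ +ℤ n₂) D D {{ℤ.positive 0<D}} (begin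
  (n₁ +ℤ n₂) *ℤ D                                     ≡⟨ ℤ.*-distribʳ-+ D n₁ n₂ ⟩
  n₁ *ℤ D +ℤ n₂ *ℤ D
    ≡⟨ cong₂ _+ℤ_ (shifted-norm x₁ x₃ x₄ (q₁ , q₂)) (shifted-norm x₂ x₃ x₄ (q₃ , q₄)) ⟩
  (e₁ +ℤ e₂) +ℤ (e₃ +ℤ e₄)                            ≡⟨ ℤ.+-assoc (e₁ +ℤ e₂) e₃ e₄ ⟨
  e₁ +ℤ e₂ +ℤ e₃ +ℤ e₄                                ≤⟨ close ⟩
  D *ℤ D                                              ∎)
  where
  open ℤ.≤-Reasoning
  δ = x₄ -ᵍ x₃
  D = norm δ
  n₁ = norm (x₁ +ᵍ (x₃ -ᵍ x₄) *ᵍ (q₁ , q₂))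
  n₂ = norm (x₂ +ᵍ (x₃ -ᵍ x₄) *ᵍ (q₃ , q₄))
  e₁ = sq (re (x₁ *ᵍ conj δ) - q₁ *ℤ D)
  e₂ = sq (im (x₁ *ᵍ conj δ) - q₂ *ℤ D)
  e₃ = sq (re (x₂ *ᵍ conj δ) - q₃ *ℤ D)
  e₄ = sq (im (x₂ *ᵍ conj δ) - q₄ *ℤ D)

eichler-sum*conjΔ : ∀ a₁ a₂ μ w → let s = conj a₁ *ᵍ π₁ w +ᵍ conj a₂ *ᵍ π₂ w ; w′ = eichler a₁ a₂ μ w ; D = norm (Δ w) in
  (π₄ w′ +ᵍ π₃ w′) *ᵍ conj (Δ w) ≡ (π₄ w +ᵍ π₃ w -ᵍ s -ᵍ s) *ᵍ conj (Δ w) -ᵍ (re (μ +ᵍ μ) *ℤ D , im (μ +ᵍ μ) *ℤ D)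
eichler-sum*conjΔ a₁ a₂ μ (quad x₁ x₂ x₃ x₄) =
  trans (tilt-sum x₃ x₄ s μ (conj δ))
        (cong (λ t → B -ᵍ t) (trans (cong ((μ +ᵍ μ) *ᵍ_) (*ᵍ-conjʳ δ)) (*ᵍ-ι (μ +ᵍ μ) (norm δ))))
  where
  δ = x₄ -ᵍ x₃
  s = conj a₁ *ᵍ x₁ +ᵍ conj a₂ *ᵍ x₂
  B = (x₄ +ᵍ x₃ -ᵍ s -ᵍ s) *ᵍ conj δ
  tilt-sum : ∀ x₃ x₄ s μ c → ((x₄ -ᵍ s +ᵍ μ *ᵍ (x₃ -ᵍ x₄)) +ᵍ (x₃ -ᵍ s +ᵍ μ *ᵍ (x₃ -ᵍ x₄))) *ᵍ c
                             ≡ (x₄ +ᵍ x₃ -ᵍ s -ᵍ s) *ᵍ c -ᵍ (μ +ᵍ μ) *ᵍ ((x₄ -ᵍ x₃) *ᵍ c)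
  tilt-sum = solve-∀ ℤ[i]-ring

reduce : ∀ w → Δ w ≢ 0ᵍ → Reduction w
reduce w@(quad x₁ x₂ x₃ x₄) δ≢0 = withApproximation (evenApproximation₄ (re T₁) (im T₁) (re T₂) (im T₂) D 0<D)
  where
  δ = x₄ -ᵍ x₃
  D = norm δ
  0<D = ≢0ᵍ⇒0<norm δ δ≢0
  T₁ = x₁ *ᵍ conj δ
  T₂ = x₂ *ᵍ conj δ
  withApproximation : EvenApproximation (re T₁) (im T₁) (re T₂) (im T₂) D → Reduction w
  withApproximation (evenApproximation q₁ q₂ q₃ q₄ (h , even) close) =
    withShift (nearestMultiple (im B) (D +ℤ D) (ℤ.+-mono-< 0<D 0<D))
    where
    a₁ a₂ s B : ℤ[i]
    a₁ = (q₁ , q₂)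
    a₂ = (q₃ , q₄)
    s = conj a₁ *ᵍ x₁ +ᵍ conj a₂ *ᵍ x₂
    B = (x₄ +ᵍ x₃ -ᵍ s -ᵍ s) *ᵍ conj δ
    withShift : (∃ λ τ → HalfBounded (D +ℤ D) (im B - τ *ℤ (D +ℤ D))) → Reduction w
    withShift (τ , halfBounded lower upper) = reduction a₁ a₂ μ (admissible-even q₁ q₂ q₃ q₄ h τ even)
      (subst (λ d → norm (π₁ w′) +ℤ norm (π₂ w′) ≤ norm d) (sym Δw′≡δ) (shifted-pair≤ x₁ x₂ x₃ x₄ q₁ q₂ q₃ q₄ 0<D close))
      (subst (λ d → - norm d ≤ im ((π₄ w′ +ᵍ π₃ w′) *ᵍ conj d)) (sym Δw′≡δ)
        (subst (- D ≤_) (sym imP≡r) (halve-≤ (subst (_≤ r +ℤ r) (ℤ.neg-distrib-+ D D) lower))))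
      (subst (λ d → im ((π₄ w′ +ᵍ π₃ w′) *ᵍ conj d) ≤ norm d) (sym Δw′≡δ) (subst (_≤ D) (sym imP≡r) (halve-≤ upper)))
      where
      μ : ℤ[i]
      μ = (- h , τ)
      w′ = eichler a₁ a₂ μ w
      Δw′≡δ : Δ w′ ≡ δ
      Δw′≡δ = eichler-δ a₁ a₂ μ w
      r = im B - τ *ℤ (D +ℤ D)
      imP≡r : im ((π₄ w′ +ᵍ π₃ w′) *ᵍ conj δ) ≡ r
      imP≡r = trans (cong im (eichler-sum*conjΔ a₁ a₂ μ w)) (regroup (im B) τ D)
        where
        regroup : ∀ b τ D → b - (τ +ℤ τ) *ℤ D ≡ b - τ *ℤ (D +ℤ D)
        regroup = ℤ-Solver.solve-∀

descend-reduced : ∀ w → Isotropic w → Δ w ≢ 0ᵍ → norm (π₁ w) +ℤ norm (π₂ w) ≤ norm (Δ w) →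
                  - norm (Δ w) ≤ im ((π₄ w +ᵍ π₃ w) *ᵍ conj (Δ w)) → im ((π₄ w +ᵍ π₃ w) *ᵍ conj (Δ w)) ≤ norm (Δ w) →
                  (∀ w′ → measure w′ ℕ.< measure w → Isotropic w′ → UnitOrthogonal w′) → UnitOrthogonal w
descend-reduced w iso Δw≢0 first-two im-lower im-upper recurse =
  [ unitOrthogonal-π₃≡0 w , via-unit ]′ (shrink (π₁ w) (π₂ w) (π₃ w) (π₄ w) iso Δw≢0 first-two im-lower im-upper)
  where
  via-unit : ∃ (λ u → Unit u × norm (π₄ w -ᵍ u *ᵍ π₃ w) < norm (Δ w)) → UnitOrthogonal w
  via-unit (u , unit , smaller) =
    unitOrthogonal-scale₃ u unit w (recurse (scale₃ u w) (∣∣-mono-< (0≤norm (π₄ w -ᵍ u *ᵍ π₃ w)) smaller)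
                                            (trans (scale₃-isometry u unit w w) iso))

descend : ∀ w → Isotropic w → π₁ w ≢ 0ᵍ →
          (∀ w′ → measure w′ ℕ.< measure w → Isotropic w′ → UnitOrthogonal w′) → UnitOrthogonal w
descend w iso x₁≢0 recurse = fromReduction (reduce w Δw≢0)
  where
  Δw≢0 = Δ≢0ᵍ w iso x₁≢0
  fromReduction : Reduction w → UnitOrthogonal w
  fromReduction (reduction a₁ a₂ μ admissible first-two im-lower im-upper) =
    unitOrthogonal-eichler a₁ a₂ μ admissible w
      (descend-reduced (eichler a₁ a₂ μ w) (trans (eichler-isometry a₁ a₂ μ admissible w w) iso)
        (subst (_≢ 0ᵍ) (sym Δw′≡Δw) Δw≢0) first-two im-lower im-upper
        (λ w′ → subst (λ m → measure w′ ℕ.< m → Isotropic w′ → UnitOrthogonal w′) (sym (cong (∣_∣ ∘ norm) Δw′≡Δw)) (recurse w′)))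
    where
    Δw′≡Δw : Δ (eichler a₁ a₂ μ w) ≡ Δ w
    Δw′≡Δw = eichler-δ a₁ a₂ μ w

isotropic⇒unitOrthogonal : ∀ w → Isotropic w → UnitOrthogonal w
isotropic⇒unitOrthogonal = All.wfRec (On.wellFounded measure <-wellFounded) 0ℓ (λ w → Isotropic w → UnitOrthogonal w) step
  where
  step : ∀ w → (∀ {w′} → measure w′ ℕ.< measure w → Isotropic w′ → UnitOrthogonal w′) → Isotropic w → UnitOrthogonal w
  step w smaller iso = [ unitOrthogonal-π₁≡0 w , (λ x₁≢0 → descend w iso x₁≢0 (λ w′ → smaller)) ]′ (toSum (π₁ w ≟ᵍ 0ᵍ))

-- Extending icubes

infixl 5 _∷ʳ_
_∷ʳ_ : Vecᵍ 3 → ℤ[i] → ℤ[i]⁴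
v ∷ʳ t = quad (v zero) (v (suc zero)) (v (suc (suc zero))) t

front : ℤ[i]⁴ → Vecᵍ 3
front z zero             = π₁ z
front z (suc zero)       = π₂ z
front z (suc (suc zero)) = π₃ z

∷ʳ-⊙ : ∀ u s v t → (u ∷ʳ s) ⊙ (v ∷ʳ t) ≡ u ⋆ v -ᵍ conj s *ᵍ t
∷ʳ-⊙ u s v t = reassociate (conj (u zero) *ᵍ v zero) (conj (u (suc zero)) *ᵍ v (suc zero))
                               (conj (u (suc (suc zero))) *ᵍ v (suc (suc zero))) (conj s *ᵍ t)
  where
  reassociate : ∀ a b c d → a +ᵍ b +ᵍ c -ᵍ d ≡ (a +ᵍ (b +ᵍ (c +ᵍ 0ᵍ))) -ᵍ d
  reassociate = solve-∀ ℤ[i]-ring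

secondColumn : ∀ c (v : Vecᵍ 3) → v ⋆ v ≡ c *ᵍ conj c → ∃ λ x → x ⋆ x ≡ c *ᵍ conj c × v ⋆ x ≡ 0ᵍ
secondColumn c v v⋆v≡L = fromUnitOrthogonal (isotropic⇒unitOrthogonal (v ∷ʳ c) isotropic)
  where
  open ≡-Reasoning
  isotropic : Isotropic (v ∷ʳ c)
  isotropic = trans (∷ʳ-⊙ v c v c) (trans (cong (_-ᵍ conj c *ᵍ c) v⋆v≡L) (cancel c (conj c)))
    where
    cancel : ∀ c c̄ → c *ᵍ c̄ -ᵍ c̄ *ᵍ c ≡ 0ᵍ
    cancel = solve-∀ ℤ[i]-ring
  fromUnitOrthogonal : UnitOrthogonal (v ∷ʳ c) → ∃ λ x → x ⋆ x ≡ c *ᵍ conj c × v ⋆ x ≡ 0ᵍ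
  fromUnitOrthogonal record { z = z ; orthogonal = orthogonal ; unit = unit } = x , x⋆x≡L , v⋆x≡0
    where
    κ = π₄ z
    z′ = front z
    x : Vecᵍ 3
    x i = c *ᵍ z′ i -ᵍ κ *ᵍ v i
    v⋆z′ : v ⋆ z′ ≡ conj c *ᵍ κ
    v⋆z′ = x-ᵍy≡0ᵍ⇒x≡y (v ⋆ z′) (conj c *ᵍ κ) (trans (sym (∷ʳ-⊙ v c z′ κ)) orthogonal)
    z′⋆v : z′ ⋆ v ≡ c *ᵍ conj κ
    z′⋆v = trans (⋆-conj v z′) (trans (cong conj v⋆z′) (trans (conj-*ᵍ (conj c) κ) (cong (_*ᵍ conj κ) (conj-involutive c))))
    z′⋆z′ : z′ ⋆ z′ ≡ 1ᵍ +ᵍ conj κ *ᵍ κ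
    z′⋆z′ = trans (add-back (z′ ⋆ z′) (conj κ *ᵍ κ)) (cong (_+ᵍ conj κ *ᵍ κ) (trans (sym (∷ʳ-⊙ z′ κ z′ κ)) unit))
      where
      add-back : ∀ a b → a ≡ (a -ᵍ b) +ᵍ b
      add-back = solve-∀ ℤ[i]-ring
    v⋆x≡0 : v ⋆ x ≡ 0ᵍ
    v⋆x≡0 = begin
      v ⋆ x                                 ≡⟨ ⋆-combinationʳ v z′ v c κ ⟩
      c *ᵍ (v ⋆ z′) -ᵍ κ *ᵍ (v ⋆ v)         ≡⟨ cong₂ (λ p q → c *ᵍ p -ᵍ κ *ᵍ q) v⋆z′ v⋆v≡L ⟩
      c *ᵍ (conj c *ᵍ κ) -ᵍ κ *ᵍ (c *ᵍ conj c) ≡⟨ cancel c (conj c) κ ⟩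
      0ᵍ                                    ∎
      where
      cancel : ∀ c c̄ κ → c *ᵍ (c̄ *ᵍ κ) -ᵍ κ *ᵍ (c *ᵍ c̄) ≡ 0ᵍ
      cancel = solve-∀ ℤ[i]-ring
    x⋆x≡L : x ⋆ x ≡ c *ᵍ conj c
    x⋆x≡L = begin
      x ⋆ x                                              ≡⟨ ⋆-combinationˡ x z′ v c κ ⟩
      conj c *ᵍ (z′ ⋆ x) -ᵍ conj κ *ᵍ (v ⋆ x)
        ≡⟨ cong₂ (λ p q → conj c *ᵍ p -ᵍ conj κ *ᵍ q) (⋆-combinationʳ z′ z′ v c κ) v⋆x≡0 ⟩
      conj c *ᵍ (c *ᵍ (z′ ⋆ z′) -ᵍ κ *ᵍ (z′ ⋆ v)) -ᵍ conj κ *ᵍ 0ᵍ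
        ≡⟨ cong₂ (λ p q → conj c *ᵍ (c *ᵍ p -ᵍ κ *ᵍ q) -ᵍ conj κ *ᵍ 0ᵍ) z′⋆z′ z′⋆v ⟩
      conj c *ᵍ (c *ᵍ (1ᵍ +ᵍ conj κ *ᵍ κ) -ᵍ κ *ᵍ (c *ᵍ conj κ)) -ᵍ conj κ *ᵍ 0ᵍ ≡⟨ collapse c (conj c) κ (conj κ) ⟩
      c *ᵍ conj c                                        ∎
      where
      collapse : ∀ c c̄ κ κ̄ → c̄ *ᵍ (c *ᵍ (1ᵍ +ᵍ κ̄ *ᵍ κ) -ᵍ κ *ᵍ (c *ᵍ κ̄)) -ᵍ κ̄ *ᵍ 0ᵍ ≡ c *ᵍ c̄
      collapse = solve-∀ ℤ[i]-ring

orthogonalFrame : ∀ {lam} → lam > + 0 → ∀ u₀ u₁ u₂ →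
                  u₀ ⋆ u₀ ≡ ι lam → u₁ ⋆ u₁ ≡ ι lam → u₂ ⋆ u₂ ≡ ι lam →
                  u₀ ⋆ u₁ ≡ 0ᵍ → u₀ ⋆ u₂ ≡ 0ᵍ → u₁ ⋆ u₂ ≡ 0ᵍ → IsICube 3 3 lam (u₀ ∷ u₁ ∷ u₂ ∷ [])
orthogonalFrame {lam} 0<lam u₀ u₁ u₂ u₀⋆u₀ u₁⋆u₁ u₂⋆u₂ u₀⋆u₁ u₀⋆u₂ u₁⋆u₂ =
  s≤s z≤n , s≤s (s≤s (s≤s z≤n)) , 0<lam , diagonal , off-diagonal
  where
  swap : ∀ (u v : Vecᵍ 3) → u ⋆ v ≡ 0ᵍ → v ⋆ u ≡ 0ᵍ
  swap u v u⋆v≡0 = trans (⋆-conj u v) (cong conj u⋆v≡0)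
  diagonal : ∀ i → (u₀ ∷ u₁ ∷ u₂ ∷ []) i ⋆ (u₀ ∷ u₁ ∷ u₂ ∷ []) i ≡ ι lam
  diagonal zero             = u₀⋆u₀
  diagonal (suc zero)       = u₁⋆u₁
  diagonal (suc (suc zero)) = u₂⋆u₂
  off-diagonal : ∀ i j → i ≢ j → (u₀ ∷ u₁ ∷ u₂ ∷ []) i ⋆ (u₀ ∷ u₁ ∷ u₂ ∷ []) j ≡ 0ᵍ
  off-diagonal zero             zero             i≢j = ⊥-elim (i≢j refl)
  off-diagonal zero             (suc zero)       _   = u₀⋆u₁
  off-diagonal zero             (suc (suc zero)) _   = u₀⋆u₂
  off-diagonal (suc zero)       zero             _   = swap u₀ u₁ u₀⋆u₁
  off-diagonal (suc zero)       (suc zero)       i≢j = ⊥-elim (i≢j refl)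
  off-diagonal (suc zero)       (suc (suc zero)) _   = u₁⋆u₂
  off-diagonal (suc (suc zero)) zero             _   = swap u₀ u₂ u₀⋆u₂
  off-diagonal (suc (suc zero)) (suc zero)       _   = swap u₁ u₂ u₁⋆u₂
  off-diagonal (suc (suc zero)) (suc (suc zero)) i≢j = ⊥-elim (i≢j refl)

root≢0ᵍ : ∀ {lam} c → lam > + 0 → c *ᵍ conj c ≡ ι lam → c ≢ 0ᵍ
root≢0ᵍ {lam} c 0<lam cc̄≡lam c≡0 = ℤ.<-irrefl (sym lam≡0) 0<lam
  where
  lam≡0 : lam ≡ + 0
  lam≡0 = cong proj₁ (trans (sym cc̄≡lam) (trans (cong (_*ᵍ conj c) c≡0) (*ᵍ-zeroˡ (conj c))))

extendPair : ∀ {lam} c → lam > + 0 → c *ᵍ conj c ≡ ι lam → (A : Mat 3 2) → IsICube 3 2 lam A → ExtendsTo 3 2 3 lam A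
extendPair {lam} c 0<lam cc̄≡lam A (_ , _ , _ , diagonal , off-diagonal) =
  complete (thirdColumn c (A zero) (A (suc zero)) (root≢0ᵍ c 0<lam cc̄≡lam)
             (trans (diagonal zero) (sym cc̄≡lam)) (trans (diagonal (suc zero)) (sym cc̄≡lam)) (off-diagonal zero (suc zero) λ ()))
  where
  complete : (∃ λ s → s ⋆ s ≡ c *ᵍ conj c × A zero ⋆ s ≡ 0ᵍ × A (suc zero) ⋆ s ≡ 0ᵍ) → ExtendsTo 3 2 3 lam A
  complete (s , s⋆s , A₀⋆s , A₁⋆s) =
    (A zero ∷ A (suc zero) ∷ s ∷ [])
    , orthogonalFrame 0<lam (A zero) (A (suc zero)) s (diagonal zero) (diagonal (suc zero)) (trans s⋆s cc̄≡lam)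
                      (off-diagonal zero (suc zero) λ ()) A₀⋆s A₁⋆s
    , inject₁ , inject₁-injective , λ { zero → refl ; (suc zero) → refl }

extendSingle : ∀ {lam} c → lam > + 0 → c *ᵍ conj c ≡ ι lam → (A : Mat 3 1) → IsICube 3 1 lam A → ExtendsTo 3 1 3 lam A
extendSingle {lam} c 0<lam cc̄≡lam A (_ , _ , _ , diagonal , _) = withSecond (secondColumn c (A zero) A₀⋆A₀)
  where
  A₀⋆A₀ : A zero ⋆ A zero ≡ c *ᵍ conj c
  A₀⋆A₀ = trans (diagonal zero) (sym cc̄≡lam)
  withSecond : (∃ λ x → x ⋆ x ≡ c *ᵍ conj c × A zero ⋆ x ≡ 0ᵍ) → ExtendsTo 3 1 3 lam A
  withSecond (x , x⋆x , A₀⋆x) = withThird (thirdColumn c (A zero) x (root≢0ᵍ c 0<lam cc̄≡lam) A₀⋆A₀ x⋆x A₀⋆x)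
    where
    withThird : (∃ λ s → s ⋆ s ≡ c *ᵍ conj c × A zero ⋆ s ≡ 0ᵍ × x ⋆ s ≡ 0ᵍ) → ExtendsTo 3 1 3 lam A
    withThird (s , s⋆s , A₀⋆s , x⋆s) =
      (A zero ∷ x ∷ s ∷ [])
      , orthogonalFrame 0<lam (A zero) x s (diagonal zero) (trans x⋆x cc̄≡lam) (trans s⋆s cc̄≡lam) A₀⋆x A₀⋆s x⋆s
      , (λ _ → zero) , (λ { {zero} {zero} _ → refl }) , λ { zero → refl }

mainTheorem6 : (lam : ℤ) → lam > + 0 → SumOfTwoSquares lam →
    (k : ℕ) (A : Mat 3 k) → IsICube 3 k lam A → ExtendsTo 3 k 3 lam A
mainTheorem6 lam 0<lam (a , b , lam≡a²+b²) = extend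
  where
  c : ℤ[i]
  c = (a , b)
  cc̄≡lam : c *ᵍ conj c ≡ ι lam
  cc̄≡lam = trans (*ᵍ-conjʳ c) (cong ι (sym lam≡a²+b²))
  extend : (k : ℕ) (A : Mat 3 k) → IsICube 3 k lam A → ExtendsTo 3 k 3 lam A
  extend zero                         A (() , _)
  extend (suc zero)                   A icube = extendSingle c 0<lam cc̄≡lam A icube
  extend (suc (suc zero))             A icube = extendPair c 0<lam cc̄≡lam A icube
  extend (suc (suc (suc zero)))       A icube = A , icube , (λ j → j) , (λ j≡k → j≡k) , (λ _ → refl)
  extend (suc (suc (suc (suc k))))    A (_ , s≤s (s≤s (s≤s ())) , _)
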